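{- For every integer $n \geq 1$, the map $\rho$ is an isomorphism of posets from $(\mathsf{F}(n), \preccurlyeq_{\mathsf{Dex}})$ to $(\mathsf{Tr}(n), \preccurlyeq)$.
   Context: Dyck paths: a Dyck path of size $m$ is encoded as a word of length $2m$ over $\{0,1\}$ ($1$ = north-east step, $0$ = south-east step) with equally many $1$s and $0$s and every prefix having at least as many $1$s as $0$s; $\mathsf{Dy}(m)$ is the set of Dyck paths of size $m$. A Dyck path $d$ is primitive if whenever $d = xy$ with $x,y$ Dyck paths, $x$ or $y$ is empty. A factor $x$ of $d$ that is a Dyck path is a subpath; it is movable if $x$ is primitive and $d = p\,1\,0^{m}\,x\,s$ for some words $p,s$ and integer $m>0$, where $s$ is empty or begins with $1$. Dexter order: if $d = p\,1\,0^m\,x\,s$ with $x$ movable, then $d$ is covered by every $d_{\alpha,\beta} := p\,1\,0^{\alpha}\,x\,0^{\beta}\,s$ with $\alpha+\beta = m$, $\beta>0$; the dexter order $\preccurlyeq_{\mathsf{Dex}}$ on $\mathsf{Dy}(m)$ is the reflexive-transitive closure of these relations. For $n\ge1$, $\mathsf{F}(n)$ is the interval of $(\mathsf{Dy}(n+2),\preccurlyeq_{\mathsf{Dex}})$ between $1100(10)^n$ and $1\,1^n0^n\,100$. A valley of a Dyck path is a factor $01$; its height is the ordinate of the point between the $0$ and the $1$ (number of $1$s minus number of $0$s in the prefix ending with that $0$). The map $\rho$ on $\mathsf{F}(n)$: read $d$ from left to right with a counter $N_2$ initially $0$ and an output word $u$ initially empty; each time a factor $11$ is read, except the one formed by the first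 two letters of $d$, add $1$ to $N_2$; each time a valley of height $h$ is read, append the word $h\,2^{N_2}$ to $u$ and reset $N_2$ to $0$; $\rho(d)$ is the final $u$ (e.g. $\rho(1101001010)=100$, $\rho(1110010010)=120$). Triwords: for $n\ge1$, $\mathsf{Tr}(n)$ is the set of words $u = u_1\cdots u_n$ over $\{0,1,2\}$ with $u_1 \neq 2$ and such that there are no $i<j$ with $u_i = 0$ and $u_j = 1$. The order $\preccurlyeq$ on $\mathsf{Tr}(n)$ is componentwise: $u \preccurlyeq v$ iff $u_i \leq v_i$ for all $i$. -}

module Defs where

open import Data.Bool using (Bool; true; false)
open import Data.Nat using (ℕ; zero; suc; _+_; _*_; _∸_; _≤_; _<_)
open import Data.List using (List; []; _∷_; _++_; length; replicate)
open import Data.List.Relation.Unary.All using (All)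
open import Data.List.Relation.Binary.Pointwise using (Pointwise)
open import Data.Product using (Σ; ∃; _×_; _,_)
open import Data.Sum using (_⊎_)
open import Data.Empty using (⊥)
open import Relation.Binary.PropositionalEquality using (_≡_)
open import Relation.Binary.Construct.Closure.ReflexiveTransitive using (Star)

-- Words over {0,1}: `true` encodes the letter 1 (north-east step),
-- `false` encodes the letter 0 (south-east step).
Word : Set
Word = List Bool

#1 : Word → ℕ
#1 [] = 0
#1 (true ∷ w) = suc (#1 w)
#1 (false ∷ w) = #1 w

#0 : Word → ℕ
#0 [] = 0
#0 (true ∷ w) = #0 w
#0 (false ∷ w) = suc (#0 w)

IsDyck : Word → Set
IsDyck w = (#1 w ≡ #0 w) × (∀ p s → w ≡ p ++ s → #0 p ≤ #1 p)

Dy : ℕ → Word → Set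
Dy m w = IsDyck w × (length w ≡ 2 * m)

Primitive : Word → Set
Primitive d = ∀ x y → IsDyck x → IsDyck y → d ≡ x ++ y → (x ≡ []) ⊎ (y ≡ [])

zeros : ℕ → Word
zeros k = replicate k false

EmptyOrStartsWith1 : Word → Set
EmptyOrStartsWith1 s = (s ≡ []) ⊎ (Σ Word λ s' → s ≡ true ∷ s')

DexStep : Word → Word → Set
DexStep d e =
  Σ Word λ p → Σ Word λ x → Σ Word λ s → Σ ℕ λ m → Σ ℕ λ α → Σ ℕ λ β →
    IsDyck x × Primitive x × 0 < m × EmptyOrStartsWith1 s ×
    (α + β ≡ m) × 0 < β ×
    (d ≡ p ++ true ∷ zeros m ++ x ++ s) ×
    (e ≡ p ++ true ∷ zeros α ++ x ++ zeros β ++ s)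

DexLe : ℕ → Word → Word → Set
DexLe m = Star (λ d e → Dy m d × Dy m e × DexStep d e)

tens : ℕ → Word
tens zero = []
tens (suc n) = true ∷ false ∷ tens n

ones : ℕ → Word
ones k = replicate k true

Fbot : ℕ → Word
Fbot n = true ∷ true ∷ false ∷ false ∷ tens n

Ftop : ℕ → Word
Ftop n = true ∷ ones n ++ zeros n ++ true ∷ false ∷ false ∷ []

F : ℕ → Word → Set
F n d = Dy (n + 2) d × DexLe (n + 2) (Fbot n) d × DexLe (n + 2) d (Ftop n)

-- The map ρ.  `go prev h N2 w`: prev = previously read letter,
-- h = height after reading prev, N2 = counter.
ρ-go : Bool → ℕ → ℕ → Word → List ℕ
ρ-go prev h n [] = []
ρ-go true h n (true ∷ w) = ρ-go true (suc h) (suc n) w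
ρ-go false h n (true ∷ w) = (h ∷ replicate n 2) ++ ρ-go true (suc h) 0 w
ρ-go prev h n (false ∷ w) = ρ-go false (h ∸ 1) n w

ρ : Word → List ℕ
ρ [] = []
-- the factor 11 formed by the first two letters is not counted
ρ (true ∷ true ∷ w) = ρ-go true 2 0 w
ρ (true ∷ false ∷ w) = ρ-go false 0 0 w
ρ (true ∷ []) = []
ρ (false ∷ w) = ρ-go false 0 0 w

Tr : ℕ → List ℕ → Set
Tr n u =
  (length u ≡ n) ×
  All (λ a → a < 3) u ×
  (∀ w → u ≡ 2 ∷ w → ⊥) ×
  (∀ p q r → u ≡ p ++ 0 ∷ q ++ 1 ∷ r → ⊥)

_≼_ : List ℕ → List ℕ → Set
u ≼ v = Pointwise _≤_ u v

-- The proof then has four parts.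
--  1. An explicit inverse σ from triwords to Dyck paths: ρ (σ u) ≡ u, and
--     σ u has size n + 2.  Triwords are described by a small grammar.
--  2. Reachability: if u ≼ v are triwords, then σ u ≤ σ v in the dexter
--     order; each step replaces u by a larger triword w ≼ v with σ u ⋖ σ w.
--     Since σ(0ⁿ) = Fbot and σ(1 2ⁿ⁻¹) = Ftop, σ lands in F(n).
--  3. Decoding: every path of F(n) starts with 11 (an invariant going up
--     from Fbot) and has valleys of height ≤ 1, no pending 2s and no
--     valley 1 after a valley 0 (an invariant going down from Ftop); such
--     a path is σ (ρ d), and ρ d is a triword.
--  4. Monotonicity: a single dexter step between paths with valleys of
--     height ≤ 2 increases ρ componentwise.
-- The theorem follows: ρ ∘ σ = id on Tr(n) and σ ∘ ρ = id on F(n), with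
-- σ and ρ monotone.
module Submission where

open import Defs
open import Data.Bool using (Bool; true; false)
open import Data.Nat using (ℕ; zero; suc; _+_; _*_; _∸_; _≤_; _<_; z≤n; s≤s; _≟_)
open import Data.Nat.Properties
open import Data.Nat.Tactic.RingSolver using (solve-∀)
open import Data.List using (List; []; _∷_; _++_; length; replicate; map)
open import Data.List.Properties using (++-assoc; ++-identityʳ; ++-conicalʳ; ∷-injectiveˡ; ∷-injectiveʳ; length-++; length-replicate; ≡-dec)
open import Data.List.Relation.Unary.All using (All; []; _∷_)
open import Data.List.Relation.Unary.Any using (Any; here; there)
open import Data.List.Relation.Unary.All.Properties using (++⁺; ++⁻ˡ; ++⁻ʳ; replicate⁺)
open import Data.List.Relation.Binary.Pointwise as PW using ([]; _∷_)
open import Data.Product using (Σ; _×_; _,_; proj₁; proj₂)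
open import Data.Sum using (_⊎_; inj₁; inj₂)
open import Data.Empty using (⊥; ⊥-elim)
open import Data.Unit using (⊤; tt)
open import Relation.Binary.PropositionalEquality
open import Relation.Binary.Construct.Closure.ReflexiveTransitive using (ε; _◅_)
open import Relation.Nullary using (yes; no)

≼-refl : ∀ (u : List ℕ) → u ≼ u
≼-refl u = PW.refl ≤-refl

≼-trans : ∀ {u v w : List ℕ} → u ≼ v → v ≼ w → u ≼ w
≼-trans = PW.transitive ≤-trans

≼-++ : ∀ {a b c d : List ℕ} → a ≼ b → c ≼ d → (a ++ c) ≼ (b ++ d)
≼-++ = PW.++⁺

replicate-+ : ∀ {A : Set} (a b : ℕ) (x : A) → replicate (a + b) x ≡ replicate a x ++ replicate b x
replicate-+ zero b x = refl
replicate-+ (suc a) b x = cong (x ∷_) (replicate-+ a b x)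

replicate-slide : ∀ {A : Set} n (x : A) (w : List A) → x ∷ (replicate n x ++ w) ≡ replicate n x ++ (x ∷ w)
replicate-slide zero x w = refl
replicate-slide (suc n) x w = cong (x ∷_) (replicate-slide n x w)

replicate-suc : ∀ {A : Set} n (x : A) → replicate (suc n) x ≡ replicate n x ++ (x ∷ [])
replicate-suc n x = trans (cong (x ∷_) (sym (++-identityʳ (replicate n x)))) (replicate-slide n x [])

#1-++ : ∀ a b → #1 (a ++ b) ≡ #1 a + #1 b
#1-++ [] b = refl
#1-++ (true ∷ a) b = cong suc (#1-++ a b)
#1-++ (false ∷ a) b = #1-++ a b

#0-++ : ∀ a b → #0 (a ++ b) ≡ #0 a + #0 b
#0-++ [] b = refl
#0-++ (true ∷ a) b = #0-++ a b
#0-++ (false ∷ a) b = cong suc (#0-++ a b)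

#1-zeros : ∀ k → #1 (zeros k) ≡ 0
#1-zeros zero = refl
#1-zeros (suc k) = #1-zeros k

#0-zeros : ∀ k → #0 (zeros k) ≡ k
#0-zeros zero = refl
#0-zeros (suc k) = cong suc (#0-zeros k)

#1-ones : ∀ k → #1 (ones k) ≡ k
#1-ones zero = refl
#1-ones (suc k) = cong suc (#1-ones k)

#0-ones : ∀ k → #0 (ones k) ≡ 0
#0-ones zero = refl
#0-ones (suc k) = #0-ones k

length-#1+#0 : ∀ w → length w ≡ #1 w + #0 w
length-#1+#0 [] = refl
length-#1+#0 (true ∷ w) = cong suc (length-#1+#0 w)
length-#1+#0 (false ∷ w) = trans (cong suc (length-#1+#0 w)) (sym (+-suc (#1 w) (#0 w)))

Nonneg : ℕ → Word → Set
Nonneg h w = ∀ p s → w ≡ p ++ s → #0 p ≤ h + #1 p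

Nonneg-[] : ∀ h → Nonneg h []
Nonneg-[] h [] s eq = z≤n
Nonneg-[] h (x ∷ p) s ()

Nonneg-up : ∀ {h w} → Nonneg (suc h) w → Nonneg h (true ∷ w)
Nonneg-up nn [] s eq = z≤n
Nonneg-up {h} nn (true ∷ p) s refl = subst (#0 p ≤_) (sym (+-suc h (#1 p))) (nn p s refl)
Nonneg-up nn (false ∷ p) s ()

Nonneg-down : ∀ {h w} → Nonneg h w → Nonneg (suc h) (false ∷ w)
Nonneg-down nn [] s eq = z≤n
Nonneg-down nn (true ∷ p) s ()
Nonneg-down nn (false ∷ p) s refl = s≤s (nn p s refl)

Nonneg-up⁻ : ∀ {h w} → Nonneg h (true ∷ w) → Nonneg (suc h) w
Nonneg-up⁻ {h} nn p s eq = subst (#0 p ≤_) (+-suc h (#1 p)) (nn (true ∷ p) s (cong (true ∷_) eq))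

Nonneg-down⁻ : ∀ {h w} → Nonneg h (false ∷ w) → Σ ℕ λ h' → (h ≡ suc h') × Nonneg h' w
Nonneg-down⁻ {zero} nn with nn (false ∷ []) _ refl
... | ()
Nonneg-down⁻ {suc h} nn = h , refl , λ p s eq → ≤-pred (nn (false ∷ p) s (cong (false ∷_) eq))

Nonneg-mono : ∀ {h h' w} → h ≤ h' → Nonneg h w → Nonneg h' w
Nonneg-mono le nn p s eq = ≤-trans (nn p s eq) (+-monoˡ-≤ _ le)

Nonneg-zeros : ∀ k h w → Nonneg h w → Nonneg (k + h) (zeros k ++ w)
Nonneg-zeros zero h w nn = nn
Nonneg-zeros (suc k) h w nn = Nonneg-down (Nonneg-zeros k h w nn)

Nonneg-zeros⁻ : ∀ h m w → Nonneg h (zeros m ++ w) → m ≤ h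
Nonneg-zeros⁻ h m w nn =
  subst₂ _≤_ (#0-zeros m) (trans (cong (h +_) (#1-zeros m)) (+-identityʳ h)) (nn (zeros m) w refl)

height : ℕ → Word → ℕ
height h [] = h
height h (true ∷ w) = height (suc h) w
height h (false ∷ w) = height (h ∸ 1) w

lastLetter : Bool → Word → Bool
lastLetter b [] = b
lastLetter b (x ∷ w) = lastLetter x w

-- The counter N₂ of factors 11 read since the last valley.
pending : Bool → ℕ → Word → ℕ
pending b n [] = n
pending b n (false ∷ w) = pending false n w
pending true n (true ∷ w) = pending true (suc n) w
pending false n (true ∷ w) = pending true 0 w

valleys : Bool → ℕ → Word → List ℕ
valleys b h [] = []
valleys b h (false ∷ w) = valleys false (h ∸ 1) w
valleys true h (true ∷ w) = valleys true (suc h) w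
valleys false h (true ∷ w) = h ∷ valleys true (suc h) w

-- ρ-go followed by a flush of the pending 2s; unlike ρ-go it is
-- compatible with extending the word, which the monotonicity proof needs.
ρ-flush : Bool → ℕ → ℕ → Word → List ℕ
ρ-flush b h n [] = replicate n 2
ρ-flush b h n (false ∷ w) = ρ-flush false (h ∸ 1) n w
ρ-flush true h n (true ∷ w) = ρ-flush true (suc h) (suc n) w
ρ-flush false h n (true ∷ w) = (h ∷ replicate n 2) ++ ρ-flush true (suc h) 0 w

ρ-go-false : ∀ b h n w → ρ-go b h n (false ∷ w) ≡ ρ-go false (h ∸ 1) n w
ρ-go-false true h n w = refl
ρ-go-false false h n w = refl

height-++ : ∀ h a b → height h (a ++ b) ≡ height (height h a) b
height-++ h [] b = refl
height-++ h (true ∷ a) b = height-++ (suc h) a b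
height-++ h (false ∷ a) b = height-++ (h ∸ 1) a b

pending-++ : ∀ b n w v → pending b n (w ++ v) ≡ pending (lastLetter b w) (pending b n w) v
pending-++ b n [] v = refl
pending-++ b n (false ∷ w) v = pending-++ false n w v
pending-++ true n (true ∷ w) v = pending-++ true (suc n) w v
pending-++ false n (true ∷ w) v = pending-++ true 0 w v

valleys-++ : ∀ b h w v → valleys b h (w ++ v) ≡ valleys b h w ++ valleys (lastLetter b w) (height h w) v
valleys-++ b h [] v = refl
valleys-++ b h (false ∷ w) v = valleys-++ false (h ∸ 1) w v
valleys-++ true h (true ∷ w) v = valleys-++ true (suc h) w v
valleys-++ false h (true ∷ w) v = cong (h ∷_) (valleys-++ true (suc h) w v)

ρ-flush-++ : ∀ b h n w v →
  ρ-flush b h n (w ++ v) ≡ ρ-go b h n w ++ ρ-flush (lastLetter b w) (height h w) (pending b n w) v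
ρ-flush-++ b h n [] v = refl
ρ-flush-++ b h n (false ∷ w) v =
  trans (ρ-flush-++ false (h ∸ 1) n w v)
        (cong (_++ ρ-flush (lastLetter false w) (height (h ∸ 1) w) (pending false n w) v) (sym (ρ-go-false b h n w)))
ρ-flush-++ true h n (true ∷ w) v = ρ-flush-++ true (suc h) (suc n) w v
ρ-flush-++ false h n (true ∷ w) v =
  trans (cong ((h ∷ replicate n 2) ++_) (ρ-flush-++ true (suc h) 0 w v))
        (sym (++-assoc (h ∷ replicate n 2) (ρ-go true (suc h) 0 w) _))

ρ-flush-split : ∀ b h n w → ρ-flush b h n w ≡ ρ-go b h n w ++ replicate (pending b n w) 2
ρ-flush-split b h n w = trans (cong (ρ-flush b h n) (sym (++-identityʳ w))) (ρ-flush-++ b h n w [])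

-- Runs of down-steps.  The plain versions start from any state and
-- read a nonempty run; the versions with subscript ₀ start after a 0.

∸-suc : ∀ h k → (h ∸ 1) ∸ k ≡ h ∸ suc k
∸-suc h k = ∸-+-assoc h 1 k

height-zeros : ∀ h k w → height h (zeros k ++ w) ≡ height (h ∸ k) w
height-zeros h zero w = refl
height-zeros h (suc k) w = trans (height-zeros (h ∸ 1) k w) (cong (λ z → height z w) (∸-suc h k))

pending-zeros : ∀ b n k w → pending b n (zeros (suc k) ++ w) ≡ pending false n w
pending-zeros b n zero w = refl
pending-zeros b n (suc k) w = pending-zeros false n k w

pending-zeros₀ : ∀ n k w → pending false n (zeros k ++ w) ≡ pending false n w
pending-zeros₀ n zero w = refl
pending-zeros₀ n (suc k) w = pending-zeros false n k w

valleys-zeros₀ : ∀ h k w → valleys false h (zeros k ++ w) ≡ valleys false (h ∸ k) w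
valleys-zeros₀ h zero w = refl
valleys-zeros₀ h (suc k) w = trans (valleys-zeros₀ (h ∸ 1) k w) (cong (λ z → valleys false z w) (∸-suc h k))

valleys-zeros : ∀ b h k w → valleys b h (zeros (suc k) ++ w) ≡ valleys false (h ∸ suc k) w
valleys-zeros b h k w = trans (valleys-zeros₀ (h ∸ 1) k w) (cong (λ z → valleys false z w) (∸-suc h k))

ρ-flush-zeros₀ : ∀ h n k w → ρ-flush false h n (zeros k ++ w) ≡ ρ-flush false (h ∸ k) n w
ρ-flush-zeros₀ h n zero w = refl
ρ-flush-zeros₀ h n (suc k) w = trans (ρ-flush-zeros₀ (h ∸ 1) n k w) (cong (λ z → ρ-flush false z n w) (∸-suc h k))

ρ-flush-zeros : ∀ b h n k w → ρ-flush b h n (zeros (suc k) ++ w) ≡ ρ-flush false (h ∸ suc k) n w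
ρ-flush-zeros b h n k w = trans (ρ-flush-zeros₀ (h ∸ 1) n k w) (cong (λ z → ρ-flush false z n w) (∸-suc h k))

ρ-go-zeros₀ : ∀ h n k w → ρ-go false h n (zeros k ++ w) ≡ ρ-go false (h ∸ k) n w
ρ-go-zeros₀ h n zero w = refl
ρ-go-zeros₀ h n (suc k) w = trans (ρ-go-zeros₀ (h ∸ 1) n k w) (cong (λ z → ρ-go false z n w) (∸-suc h k))

ρ-go-zeros : ∀ b h n k w → ρ-go b h n (zeros (suc k) ++ w) ≡ ρ-go false (h ∸ suc k) n w
ρ-go-zeros b h n k w =
  trans (ρ-go-false b h n _) (trans (ρ-go-zeros₀ (h ∸ 1) n k w) (cong (λ z → ρ-go false z n w) (∸-suc h k)))

valleys-descend : ∀ b H m W → 0 < m → valleys b (H + m) (zeros m ++ W) ≡ valleys false H W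
valleys-descend b H (suc k) W _ =
  trans (valleys-zeros b (H + suc k) k W) (cong (λ z → valleys false z W) (m+n∸n≡m H (suc k)))

valleys-descend₀ : ∀ H m W → valleys false (H + m) (zeros m ++ W) ≡ valleys false H W
valleys-descend₀ H m W = trans (valleys-zeros₀ (H + m) m W) (cong (λ z → valleys false z W) (m+n∸n≡m H m))

ρ-flush-descend : ∀ b H N m W → 0 < m → ρ-flush b (H + m) N (zeros m ++ W) ≡ ρ-flush false H N W
ρ-flush-descend b H N (suc k) W _ =
  trans (ρ-flush-zeros b (H + suc k) N k W) (cong (λ z → ρ-flush false z N W) (m+n∸n≡m H (suc k)))

ρ-flush-descend₀ : ∀ H N m W → ρ-flush false (H + m) N (zeros m ++ W) ≡ ρ-flush false H N W
ρ-flush-descend₀ H N m W = trans (ρ-flush-zeros₀ (H + m) N m W) (cong (λ z → ρ-flush false z N W) (m+n∸n≡m H m))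

height-ones : ∀ c N → height c (ones N) ≡ N + c
height-ones c zero = refl
height-ones c (suc N) = trans (height-ones (suc c) N) (+-suc N c)

pending-ones : ∀ n k w → pending true n (ones k ++ w) ≡ pending true (k + n) w
pending-ones n zero w = refl
pending-ones n (suc k) w = trans (pending-ones (suc n) k w) (cong (λ z → pending true z w) (+-suc k n))

valleys-ones : ∀ h k w → valleys true h (ones k ++ w) ≡ valleys true (k + h) w
valleys-ones h zero w = refl
valleys-ones h (suc k) w = trans (valleys-ones (suc h) k w) (cong (λ z → valleys true z w) (+-suc k h))

ρ-go-ones : ∀ h n k w → ρ-go true h n (ones k ++ w) ≡ ρ-go true (k + h) (k + n) w
ρ-go-ones h n zero w = refl
ρ-go-ones h n (suc k) w =
  trans (ρ-go-ones (suc h) (suc n) k w) (cong₂ (λ a b → ρ-go true a b w) (+-suc k h) (+-suc k n))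

ρ-go-zeros-only : ∀ h n k → ρ-go true h n (zeros k) ≡ []
ρ-go-zeros-only h n zero = refl
ρ-go-zeros-only h n (suc k) =
  trans (cong (ρ-go true h n) (sym (++-identityʳ (zeros (suc k))))) (ρ-go-zeros true h n k [])

-- For a path staying nonnegative, the height automaton computes the
-- true height, so heights can be shifted by a constant.

Nonneg-suffix : ∀ h a b → Nonneg h (a ++ b) → Nonneg (height h a) b
Nonneg-suffix h [] b nn = nn
Nonneg-suffix h (true ∷ a) b nn = Nonneg-suffix (suc h) a b (Nonneg-up⁻ nn)
Nonneg-suffix h (false ∷ a) b nn with Nonneg-down⁻ nn
... | h' , refl , nn' = Nonneg-suffix h' a b nn'

height-exact : ∀ h w → Nonneg h w → height h w + #0 w ≡ h + #1 w
height-exact h [] nn = refl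
height-exact h (true ∷ w) nn = trans (height-exact (suc h) w (Nonneg-up⁻ nn)) (sym (+-suc h (#1 w)))
height-exact h (false ∷ w) nn with Nonneg-down⁻ nn
... | h' , refl , nn' = trans (+-suc (height h' w) (#0 w)) (cong suc (height-exact h' w nn'))

height-Dyck : ∀ d → IsDyck d → height 0 d ≡ 0
height-Dyck d (bal , nn) = +-cancelʳ-≡ (#0 d) (height 0 d) 0 (trans (height-exact 0 d nn) bal)

height-shift : ∀ k L w → Nonneg k w → height (k + L) w ≡ height k w + L
height-shift k L [] nn = refl
height-shift k L (true ∷ w) nn = height-shift (suc k) L w (Nonneg-up⁻ nn)
height-shift k L (false ∷ w) nn with Nonneg-down⁻ nn
... | k' , refl , nn' = height-shift k' L w nn'

valleys-shift : ∀ b k L w → Nonneg k w → valleys b (k + L) w ≡ map (_+ L) (valleys b k w)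
valleys-shift b k L [] nn = refl
valleys-shift b k L (false ∷ w) nn with Nonneg-down⁻ nn
... | k' , refl , nn' = valleys-shift false k' L w nn'
valleys-shift true k L (true ∷ w) nn = valleys-shift true (suc k) L w (Nonneg-up⁻ nn)
valleys-shift false k L (true ∷ w) nn = cong ((k + L) ∷_) (valleys-shift true (suc k) L w (Nonneg-up⁻ nn))

lastLetter-descent : ∀ b h w → Nonneg h w → #1 w + h ≡ #0 w → (b ≡ false ⊎ 1 ≤ h) → lastLetter b w ≡ false
lastLetter-descent b zero [] nn bal (inj₁ e) = e
lastLetter-descent b zero [] nn bal (inj₂ ())
lastLetter-descent b (suc h) [] nn () c
lastLetter-descent b h (true ∷ w) nn bal c =
  lastLetter-descent true (suc h) w (Nonneg-up⁻ nn) (trans (+-suc (#1 w) h) bal) (inj₂ (s≤s z≤n))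
lastLetter-descent b h (false ∷ w) nn bal c with Nonneg-down⁻ nn
... | h' , refl , nn' =
  lastLetter-descent false h' w nn' (suc-injective (trans (sym (+-suc (#1 w) h')) bal)) (inj₁ refl)

-- Outputs are valley heights (bounded below by the starting offset L) or 2s.
ρ-go-lower : ∀ b k L n w → Nonneg k w → L ≤ 2 → All (L ≤_) (ρ-go b (k + L) n w)
ρ-go-lower b k L n [] nn L≤2 = []
ρ-go-lower b k L n (false ∷ w) nn L≤2 with Nonneg-down⁻ nn
... | k' , refl , nn' =
  subst (All (L ≤_)) (sym (ρ-go-false b (suc k' + L) n w)) (ρ-go-lower false k' L n w nn' L≤2)
ρ-go-lower true k L n (true ∷ w) nn L≤2 = ρ-go-lower true (suc k) L (suc n) w (Nonneg-up⁻ nn) L≤2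
ρ-go-lower false k L n (true ∷ w) nn L≤2 =
  m≤n+m L k ∷ ++⁺ (replicate⁺ n L≤2) (ρ-go-lower true (suc k) L 0 w (Nonneg-up⁻ nn) L≤2)

-- Starting higher raises every output letter (valleys rise, 2s stay).
ρ-go-mono : ∀ b h h' n w → h ≤ h' → ρ-go b h n w ≼ ρ-go b h' n w
ρ-go-mono b h h' n [] le = []
ρ-go-mono b h h' n (false ∷ w) le =
  subst₂ _≼_ (sym (ρ-go-false b h n w)) (sym (ρ-go-false b h' n w))
    (ρ-go-mono false (h ∸ 1) (h' ∸ 1) n w (∸-monoˡ-≤ 1 le))
ρ-go-mono true h h' n (true ∷ w) le = ρ-go-mono true (suc h) (suc h') (suc n) w (s≤s le)
ρ-go-mono false h h' n (true ∷ w) le = le ∷ ≼-++ (≼-refl (replicate n 2)) (ρ-go-mono true (suc h) (suc h') 0 w (s≤s le))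

ρ-flush-≤2 : ∀ b h n w → All (_≤ 2) (valleys b h w) → All (_≤ 2) (ρ-flush b h n w)
ρ-flush-≤2 b h n [] a = replicate⁺ n ≤-refl
ρ-flush-≤2 b h n (false ∷ w) a = ρ-flush-≤2 false (h ∸ 1) n w a
ρ-flush-≤2 true h n (true ∷ w) a = ρ-flush-≤2 true (suc h) (suc n) w a
ρ-flush-≤2 false h n (true ∷ w) (p ∷ a) = p ∷ ++⁺ (replicate⁺ n ≤-refl) (ρ-flush-≤2 true (suc h) 0 w a)

pending-mono : ∀ b n n' w → n ≤ n' → pending b n w ≤ pending b n' w
pending-mono b n n' [] le = le
pending-mono b n n' (false ∷ w) le = pending-mono false n n' w le
pending-mono true n n' (true ∷ w) le = pending-mono true (suc n) (suc n') w (s≤s le)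
pending-mono false n n' (true ∷ w) le = ≤-refl

insert2s : ℕ → List ℕ → List ℕ
insert2s k [] = replicate k 2
insert2s k (x ∷ r) = x ∷ (replicate k 2 ++ r)

ρ-flush-insert : ∀ b c k N w → ρ-flush b c (k + N) w ≡ insert2s k (ρ-flush b c N w)
ρ-flush-insert b c k zero [] = cong (λ z → replicate z 2) (+-identityʳ k)
ρ-flush-insert b c k (suc N) [] =
  trans (cong (λ z → replicate z 2) (+-suc k N)) (cong (2 ∷_) (replicate-+ k N 2))
ρ-flush-insert b c k N (false ∷ w) = ρ-flush-insert false (c ∸ 1) k N w
ρ-flush-insert true c k N (true ∷ w) =
  trans (cong (λ z → ρ-flush true (suc c) z w) (sym (+-suc k N))) (ρ-flush-insert true (suc c) k (suc N) w)
ρ-flush-insert false c k N (true ∷ w) =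
  cong (c ∷_) (trans (cong (_++ ρ-flush true (suc c) 0 w) (replicate-+ k N 2))
                     (++-assoc (replicate k 2) (replicate N 2) _))

-- Triwords through a grammar.  `After0 r`: r may follow a letter 0, i.e.
-- r ∈ {0,2}*; `After1 r`: r may follow a letter 1, i.e. r ∈ {0,1,2}*
-- without a 1 after a 0.  A triword is a word ℓ r with ℓ ∈ {0,1} and r
-- allowed after ℓ.

After0 : List ℕ → Set
After0 [] = ⊤
After0 (zero ∷ r) = After0 r
After0 (suc zero ∷ r) = ⊥
After0 (suc (suc zero) ∷ r) = After0 r
After0 (suc (suc (suc _)) ∷ r) = ⊥

After1 : List ℕ → Set
After1 [] = ⊤
After1 (zero ∷ r) = After0 r
After1 (suc zero ∷ r) = After1 r
After1 (suc (suc zero) ∷ r) = After1 r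
After1 (suc (suc (suc _)) ∷ r) = ⊥

After : ℕ → List ℕ → Set
After zero = After0
After (suc zero) = After1
After (suc (suc _)) _ = ⊥

IsTri : List ℕ → Set
IsTri [] = ⊥
IsTri (h ∷ r) = After h r

After0⇒After1 : ∀ r → After0 r → After1 r
After0⇒After1 [] g = tt
After0⇒After1 (zero ∷ r) g = g
After0⇒After1 (suc (suc zero) ∷ r) g = After0⇒After1 r g

After-≤1 : ∀ p r → After p r → p ≤ 1
After-≤1 zero r g = z≤n
After-≤1 (suc zero) r g = s≤s z≤n

After-≤2 : ∀ p r → After p r → All (_≤ 2) r
After-≤2 p [] g = []
After-≤2 zero (zero ∷ r) g = z≤n ∷ After-≤2 zero r g
After-≤2 zero (suc (suc zero) ∷ r) g = ≤-refl ∷ After-≤2 zero r g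
After-≤2 (suc zero) (zero ∷ r) g = z≤n ∷ After-≤2 zero r g
After-≤2 (suc zero) (suc zero ∷ r) g = s≤s z≤n ∷ After-≤2 1 r g
After-≤2 (suc zero) (suc (suc zero) ∷ r) g = ≤-refl ∷ After-≤2 1 r g

After-valley : ∀ p x r → After p (x ∷ r) → x ≤ 1 → x ≤ p × After x r
After-valley zero zero r g _ = z≤n , g
After-valley (suc zero) zero r g _ = z≤n , g
After-valley (suc zero) (suc zero) r g _ = ≤-refl , g
After-valley p (suc (suc x)) r g (s≤s ())

After-two : ∀ p r → After p (2 ∷ r) → After p r
After-two zero r g = g
After-two (suc zero) r g = g

After-big : ∀ p x r → After p (suc (suc (suc x)) ∷ r) → ⊥
After-big zero x r ()
After-big (suc zero) x r ()

twos : ℕ → List ℕ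
twos j = replicate j 2

HeadAtMost1 : List ℕ → Set
HeadAtMost1 rest = (rest ≡ []) ⊎ (Σ ℕ λ h → Σ (List ℕ) λ r' → (rest ≡ h ∷ r') × h ≤ 1)

split-twos : ∀ p r → After p r → Σ ℕ λ j → Σ (List ℕ) λ rest →
  (r ≡ twos j ++ rest) × After p rest × HeadAtMost1 rest
split-twos p [] g = 0 , [] , refl , g , inj₁ refl
split-twos zero (zero ∷ r) g = 0 , _ , refl , g , inj₂ (0 , r , refl , z≤n)
split-twos zero (suc (suc zero) ∷ r) g with split-twos zero r g
... | j , rest , e , g' , hd = suc j , rest , cong (2 ∷_) e , g' , hd
split-twos (suc zero) (zero ∷ r) g = 0 , _ , refl , g , inj₂ (0 , r , refl , z≤n)
split-twos (suc zero) (suc zero ∷ r) g = 0 , _ , refl , g , inj₂ (1 , r , refl , s≤s z≤n)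
split-twos (suc zero) (suc (suc zero) ∷ r) g with split-twos 1 r g
... | j , rest , e , g' , hd = suc j , rest , cong (2 ∷_) e , g' , hd

-- The inverse map.  `σ-go c p r` is the rest of the path when the current
-- height is c and a valley of height p is still to be drawn: each letter 2
-- is a factor 11 (an up-step); a letter x ≤ 1 or the end of the word draws
-- the valley p, and x becomes the next valley.
σ-go : ℕ → ℕ → List ℕ → Word
σ-go c p [] = zeros (c ∸ p) ++ true ∷ zeros (suc p)
σ-go c p (zero ∷ r) = zeros (c ∸ p) ++ true ∷ σ-go (suc p) 0 r
σ-go c p (suc zero ∷ r) = zeros (c ∸ p) ++ true ∷ σ-go (suc p) 1 r
σ-go c p (suc (suc _) ∷ r) = true ∷ σ-go (suc c) p r

σ-tail : ℕ → List ℕ → Word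
σ-tail c [] = zeros c
σ-tail c (h ∷ r) = σ-go c h r

σ : List ℕ → Word
σ u = true ∷ true ∷ σ-tail 2 u

σ-go-valley : ∀ c p x r → x ≤ 1 → σ-go c p (x ∷ r) ≡ zeros (c ∸ p) ++ true ∷ σ-go (suc p) x r
σ-go-valley c p zero r _ = refl
σ-go-valley c p (suc zero) r _ = refl
σ-go-valley c p (suc (suc x)) r (s≤s ())

σ-go-twos : ∀ c p j r → σ-go c p (twos j ++ r) ≡ ones j ++ σ-go (j + c) p r
σ-go-twos c p zero r = refl
σ-go-twos c p (suc j) r =
  cong (true ∷_) (trans (σ-go-twos (suc c) p j r) (cong (λ z → ones j ++ σ-go z p r) (+-suc j c)))

σ-go-next : ∀ c p rest → HeadAtMost1 rest → σ-go c p rest ≡ zeros (c ∸ p) ++ true ∷ σ-tail (suc p) rest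
σ-go-next c p .[] (inj₁ refl) = refl
σ-go-next c p .(x ∷ r') (inj₂ (x , r' , refl , x≤1)) = σ-go-valley c p x r' x≤1

Descends : ℕ → Word → Set
Descends c w = Nonneg c w × (#1 w + c ≡ #0 w)

zeros-descend : ∀ k → Descends k (zeros k)
zeros-descend k =
  subst₂ Nonneg (+-identityʳ k) (++-identityʳ (zeros k)) (Nonneg-zeros k 0 [] (Nonneg-[] 0)) ,
  trans (cong (_+ k) (#1-zeros k)) (sym (#0-zeros k))

descend-valley : ∀ c p W → p ≤ c → Descends (suc p) W →
  Descends c (zeros (c ∸ p) ++ true ∷ W) × (#1 (zeros (c ∸ p) ++ true ∷ W) ≡ suc (#1 W))
descend-valley c p W p≤c (nn , bal) =
  (subst (λ z → Nonneg z V) c∸p+p (Nonneg-zeros k p (true ∷ W) (Nonneg-up nn)) , balance) , e1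
  where
  open ≡-Reasoning
  k : ℕ
  k = c ∸ p
  V : Word
  V = zeros k ++ true ∷ W
  c∸p+p : k + p ≡ c
  c∸p+p = m∸n+n≡m p≤c
  e1 : #1 V ≡ suc (#1 W)
  e1 = trans (#1-++ (zeros k) (true ∷ W)) (cong (_+ suc (#1 W)) (#1-zeros k))
  reassoc : ∀ a k p → suc a + (k + p) ≡ k + (a + suc p)
  reassoc = solve-∀
  balance : #1 V + c ≡ #0 V
  balance = begin
    #1 V + c              ≡⟨ cong₂ _+_ e1 (sym c∸p+p) ⟩
    suc (#1 W) + (k + p)  ≡⟨ reassoc (#1 W) k p ⟩
    k + (#1 W + suc p)    ≡⟨ cong (k +_) bal ⟩
    k + #0 W              ≡⟨ cong (_+ #0 W) (sym (#0-zeros k)) ⟩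
    #0 (zeros k) + #0 W   ≡⟨ sym (#0-++ (zeros k) (true ∷ W)) ⟩
    #0 V                  ∎

σ-go-descends : ∀ r c p → p ≤ c → Descends c (σ-go c p r) × (#1 (σ-go c p r) ≡ suc (length r))
σ-go-descends [] c p p≤c with descend-valley c p (zeros (suc p)) p≤c (zeros-descend (suc p))
... | d , e = d , trans e (cong suc (#1-zeros (suc p)))
σ-go-descends (zero ∷ r) c p p≤c = valley-case (σ-go-descends r (suc p) 0 z≤n)
  where
  valley-case : ∀ {W} → Descends (suc p) W × (#1 W ≡ suc (length r)) →
    Descends c (zeros (c ∸ p) ++ true ∷ W) × (#1 (zeros (c ∸ p) ++ true ∷ W) ≡ suc (suc (length r)))
  valley-case {W} (d , e) with descend-valley c p W p≤c d
  ... | d' , e' = d' , trans e' (cong suc e)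
σ-go-descends (suc zero ∷ r) c p p≤c = valley-case (σ-go-descends r (suc p) 1 (s≤s z≤n))
  where
  valley-case : ∀ {W} → Descends (suc p) W × (#1 W ≡ suc (length r)) →
    Descends c (zeros (c ∸ p) ++ true ∷ W) × (#1 (zeros (c ∸ p) ++ true ∷ W) ≡ suc (suc (length r)))
  valley-case {W} (d , e) with descend-valley c p W p≤c d
  ... | d' , e' = d' , trans e' (cong suc e)
σ-go-descends (suc (suc _) ∷ r) c p p≤c with σ-go-descends r (suc c) p (m≤n⇒m≤1+n p≤c)
... | (nn , bal) , e = (Nonneg-up nn , trans (sym (+-suc (#1 (σ-go (suc c) p r)) c)) bal) , cong suc e

σ-tail-descends : ∀ u → HeadAtMost1 u → Descends 2 (σ-tail 2 u) × (#1 (σ-tail 2 u) ≡ length u)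
σ-tail-descends .[] (inj₁ refl) = zeros-descend 2 , refl
σ-tail-descends .(h ∷ r) (inj₂ (h , r , refl , h≤1)) = σ-go-descends r 2 h (m≤n⇒m≤1+n h≤1)

σ-Dy : ∀ u → HeadAtMost1 u → Dy (length u + 2) (σ u)
σ-Dy u hd with σ-tail-descends u hd
... | (nn , bal) , e = (trans (+-comm 2 (#1 W)) bal , Nonneg-up (Nonneg-up nn)) , size
  where
  open ≡-Reasoning
  W : Word
  W = σ-tail 2 u
  double : ∀ a → suc (suc (a + (a + 2))) ≡ 2 * (a + 2)
  double = solve-∀
  size : length (σ u) ≡ 2 * (length u + 2)
  size = begin
    suc (suc (length W))               ≡⟨ cong (λ z → suc (suc z)) (length-#1+#0 W) ⟩
    suc (suc (#1 W + #0 W))            ≡⟨ cong (λ z → suc (suc (#1 W + z))) (sym bal) ⟩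
    suc (suc (#1 W + (#1 W + 2)))      ≡⟨ cong (λ z → suc (suc (z + (z + 2)))) e ⟩
    suc (suc (length u + (length u + 2))) ≡⟨ double (length u) ⟩
    2 * (length u + 2)                 ∎

ρ-go-valley : ∀ c p N X → p < c →
  ρ-go true c N (zeros (c ∸ p) ++ true ∷ X) ≡ p ∷ (twos N ++ ρ-go true (suc p) 0 X)
ρ-go-valley c p N X p<c with c ∸ p in eq
... | zero = ⊥-elim (m>n⇒m∸n≢0 p<c eq)
... | suc k = trans (ρ-go-zeros true c N k (true ∷ X))
                    (cong (λ z → ρ-go false z N (true ∷ X)) (trans (cong (c ∸_) (sym eq)) (m∸[m∸n]≡n (<⇒≤ p<c))))

ρ-σ-valley : ∀ x r c p N → x ≤ 1 → p < c → ρ-go true (suc p) 0 (σ-go (suc p) x r) ≡ x ∷ r →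
  ρ-go true c N (σ-go c p (x ∷ r)) ≡ p ∷ (twos N ++ x ∷ r)
ρ-σ-valley x r c p N x≤1 p<c ih = begin
  ρ-go true c N (σ-go c p (x ∷ r))                           ≡⟨ cong (ρ-go true c N) (σ-go-valley c p x r x≤1) ⟩
  ρ-go true c N (zeros (c ∸ p) ++ true ∷ σ-go (suc p) x r)   ≡⟨ ρ-go-valley c p N _ p<c ⟩
  p ∷ (twos N ++ ρ-go true (suc p) 0 (σ-go (suc p) x r))      ≡⟨ cong (λ z → p ∷ (twos N ++ z)) ih ⟩
  p ∷ (twos N ++ x ∷ r)                                      ∎
  where open ≡-Reasoning

ρ-σ-go : ∀ r c p N → p < c → After p r → ρ-go true c N (σ-go c p r) ≡ p ∷ (twos N ++ r)
ρ-σ-go [] c p N p<c g =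
  trans (ρ-go-valley c p N (zeros (suc p)) p<c) (cong (λ z → p ∷ (twos N ++ z)) (ρ-go-zeros-only (suc p) 0 (suc p)))
ρ-σ-go (zero ∷ r) c p N p<c g with After-valley p 0 r g z≤n
... | 0≤p , g' = ρ-σ-valley 0 r c p N z≤n p<c (ρ-σ-go r (suc p) 0 0 (s≤s 0≤p) g')
ρ-σ-go (suc zero ∷ r) c p N p<c g with After-valley p 1 r g ≤-refl
... | 1≤p , g' = ρ-σ-valley 1 r c p N ≤-refl p<c (ρ-σ-go r (suc p) 1 0 (s≤s 1≤p) g')
ρ-σ-go (suc (suc zero) ∷ r) c p N p<c g =
  trans (ρ-σ-go r (suc c) p (suc N) (m≤n⇒m≤1+n p<c) (After-two p r g)) (cong (p ∷_) (replicate-slide N 2 r))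
ρ-σ-go (suc (suc (suc x)) ∷ r) c p N p<c g = ⊥-elim (After-big p x r g)

ρ-σ : ∀ u → IsTri u → ρ (σ u) ≡ u
ρ-σ (h ∷ r) g = ρ-σ-go r 2 h 0 (s≤s (After-≤1 h r g)) g

up-descend : ∀ h w → Descends (suc h) w → Descends h (true ∷ w)
up-descend h w (nn , bal) = Nonneg-up nn , trans (sym (+-suc (#1 w) h)) bal

ones-descend : ∀ k h w → Descends (k + h) w → Descends h (ones k ++ w)
ones-descend zero h w d = d
ones-descend (suc k) h w d =
  up-descend h (ones k ++ w) (ones-descend k (suc h) w (subst (λ z → Descends z w) (sym (+-suc k h)) d))

-- The pyramid 1 1ᵏ 0ᵏ⁺¹ is the primitive Dyck path moved by all our steps.
pyramid : ℕ → Word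
pyramid k = true ∷ (ones k ++ zeros (suc k))

pyramid-Dyck : ∀ k → IsDyck (pyramid k)
pyramid-Dyck k with up-descend 0 (ones k ++ zeros (suc k)) (ones-descend k 1 (zeros (suc k)) zs)
  where
  zs : Descends (k + 1) (zeros (suc k))
  zs = subst (λ z → Descends z (zeros (suc k))) (+-comm 1 k) (zeros-descend (suc k))
... | nn , bal = trans (sym (+-identityʳ (#1 (pyramid k)))) bal , nn

snoc-prefix : ∀ (x : Word) c y D (b : Bool) → x ++ c ∷ y ≡ D ++ b ∷ [] → Σ Word λ s → D ≡ x ++ s
snoc-prefix [] c y D b e = D , refl
snoc-prefix (a ∷ x) c y [] b e with ++-conicalʳ x (c ∷ y) (∷-injectiveʳ e)
... | ()
snoc-prefix (a ∷ x) c y (d ∷ D) b e with snoc-prefix x c y D b (∷-injectiveʳ e)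
... | s , eq = s , cong₂ _∷_ (sym (∷-injectiveˡ e)) eq

-- 1 D 0 with D nonnegative is primitive: a proper Dyck prefix 1 x would be
-- a prefix of 1 D, where the height stays positive.
lift-primitive : ∀ D → Nonneg 0 D → Primitive (true ∷ (D ++ false ∷ []))
lift-primitive D nn [] y dx dy e = inj₁ refl
lift-primitive D nn (b ∷ x) [] dx dy e = inj₂ refl
lift-primitive D nn (true ∷ x) (c ∷ y) dx dy e with snoc-prefix x c y D false (∷-injectiveʳ (sym e))
... | s , eq = ⊥-elim (1+n≰n (subst (_≤ #1 x) (sym (proj₁ dx)) (nn x s eq)))
lift-primitive D nn (false ∷ x) (c ∷ y) dx dy ()

pyramid-primitive : ∀ k → Primitive (pyramid k)
pyramid-primitive k = subst Primitive (cong (true ∷_) eq) (lift-primitive (ones k ++ zeros k) nn)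
  where
  eq : (ones k ++ zeros k) ++ false ∷ [] ≡ ones k ++ zeros (suc k)
  eq = trans (++-assoc (ones k) (zeros k) (false ∷ [])) (cong (ones k ++_) (sym (replicate-suc k false)))
  nn : Nonneg 0 (ones k ++ zeros k)
  nn = proj₁ (ones-descend k 0 (zeros k) (subst (λ z → Descends z (zeros k)) (sym (+-identityʳ k)) (zeros-descend k)))

pyramid-step : ∀ {d e} P k s m α β → EmptyOrStartsWith1 s → 0 < m → α + β ≡ m → 0 < β →
  d ≡ P ++ true ∷ zeros m ++ pyramid k ++ s → e ≡ P ++ true ∷ zeros α ++ pyramid k ++ zeros β ++ s → DexStep d e
pyramid-step P k s m α β s-ok 0<m α+β 0<β ed ee =
  P , pyramid k , s , m , α , β , pyramid-Dyck k , pyramid-primitive k , 0<m , s-ok , α+β , 0<β , ed , ee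

pyramid-++ : ∀ k Y → pyramid k ++ Y ≡ true ∷ ones k ++ zeros (suc k) ++ Y
pyramid-++ k Y = cong (true ∷_) (++-assoc (ones k) (zeros (suc k)) Y)

ones-slide : ∀ (Q : Word) j Z → Q ++ true ∷ ones j ++ Z ≡ (Q ++ ones j) ++ true ∷ Z
ones-slide Q j Z = trans (cong (Q ++_) (replicate-slide j true Z)) (sym (++-assoc Q (ones j) (true ∷ Z)))

slide-pyramid-left : ∀ Q M j T → 0 < M →
  DexStep (Q ++ true ∷ zeros M ++ true ∷ ones j ++ zeros (suc j) ++ true ∷ T)
          (Q ++ true ∷ true ∷ ones j ++ zeros (suc j + M) ++ true ∷ T)
slide-pyramid-left Q M j T 0<M = pyramid-step Q j (true ∷ T) M 0 M (inj₂ (T , refl)) 0<M refl 0<M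
  (cong (λ z → Q ++ true ∷ zeros M ++ z) (sym (pyramid-++ j (true ∷ T))))
  (cong (λ z → Q ++ true ∷ z) (sym (trans (pyramid-++ j (zeros M ++ true ∷ T))
     (cong (λ z → true ∷ ones j ++ z)
       (trans (sym (++-assoc (zeros (suc j)) (zeros M) (true ∷ T))) (cong (_++ true ∷ T) (sym (replicate-+ (suc j) M false))))))))

slide-last-peak : ∀ Q j → DexStep (Q ++ true ∷ ones j ++ zeros (2 + j) ++ true ∷ false ∷ [])
                                  (Q ++ true ∷ ones j ++ zeros (1 + j) ++ true ∷ false ∷ false ∷ [])
slide-last-peak Q j =
  pyramid-step (Q ++ ones j) 0 [] (2 + j) (1 + j) 1 (inj₁ refl) (s≤s z≤n) (+-comm (suc j) 1) (s≤s z≤n)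
    (ones-slide Q j _) (ones-slide Q j _)

slide-pyramid-once : ∀ Q j k T →
  DexStep (Q ++ true ∷ ones j ++ zeros (2 + j) ++ true ∷ ones k ++ zeros (1 + k) ++ true ∷ T)
          (Q ++ true ∷ ones j ++ zeros (1 + j) ++ true ∷ ones k ++ zeros (2 + k) ++ true ∷ T)
slide-pyramid-once Q j k T =
  pyramid-step (Q ++ ones j) k (true ∷ T) (2 + j) (1 + j) 1 (inj₂ (T , refl)) (s≤s z≤n) (+-comm (suc j) 1) (s≤s z≤n)
    (trans (ones-slide Q j _) (cong (λ z → (Q ++ ones j) ++ true ∷ zeros (2 + j) ++ z) (sym (pyramid-++ k (true ∷ T)))))
    (trans (ones-slide Q j _) (cong (λ z → (Q ++ ones j) ++ true ∷ zeros (1 + j) ++ z)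
       (trans (cong (λ z → true ∷ ones k ++ z) (replicate-slide (suc k) false (true ∷ T)))
              (sym (pyramid-++ k (false ∷ true ∷ T))))))

shift-p : ∀ j p → j + suc p ∸ p ≡ suc j
shift-p j p = trans (cong (_∸ p) (+-suc j p)) (m+n∸n≡m (suc j) p)

shift-cur : ∀ j cur p → p ≤ cur → j + suc cur ∸ p ≡ suc j + (cur ∸ p)
shift-cur j cur p le = trans (cong (_∸ p) (+-suc j cur)) (+-∸-assoc (suc j) le)

σ-step-raise : ∀ Q cur p r → p < cur → After p r →
  DexStep (Q ++ true ∷ σ-go cur p (p ∷ r)) (Q ++ true ∷ σ-go cur p (2 ∷ r))
σ-step-raise Q cur p r p<cur g
  rewrite σ-go-valley cur p p r (After-≤1 p r g) with split-twos p r g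
... | j , rest , refl , g' , hd
  rewrite σ-go-twos (suc p) p j rest | σ-go-twos (suc cur) p j rest
        | σ-go-next (j + suc p) p rest hd | σ-go-next (j + suc cur) p rest hd
        | shift-p j p | shift-cur j cur p (<⇒≤ p<cur) =
  slide-pyramid-left Q (cur ∸ p) j (σ-tail (suc p) rest) (m<n⇒0<n∸m p<cur)

-- Replacing by 1 a letter 0 that follows a valley 1 is a dexter step: the
-- tail is 2ʲ or 2ʲ 0 2ᵏ r′, and in both cases a pyramid moves by one step.
σ-step-0to1 : ∀ Q r → After0 r → DexStep (Q ++ true ∷ σ-go 2 0 r) (Q ++ true ∷ σ-go 2 1 r)
σ-step-0to1 Q r g with split-twos 0 r g
... | j , .[] , refl , g' , inj₁ refl rewrite σ-go-twos 2 0 j [] | σ-go-twos 2 1 j [] | +-comm j 2 = slide-last-peak Q j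
... | j , .(suc zero ∷ r2) , refl , () , inj₂ (suc zero , r2 , refl , _)
... | j , .(suc (suc _) ∷ r2) , refl , g' , inj₂ (suc (suc _) , r2 , refl , s≤s ())
... | j , .(zero ∷ r2) , refl , g' , inj₂ (zero , r2 , refl , _) with split-twos 0 r2 g'
... | k , rest2 , refl , g'' , hd2
  rewrite σ-go-twos 2 0 j (zero ∷ twos k ++ rest2) | σ-go-twos 2 1 j (zero ∷ twos k ++ rest2) | +-comm j 2
        | σ-go-twos 1 0 k rest2 | σ-go-twos 2 0 k rest2 | σ-go-next (k + 1) 0 rest2 hd2 | σ-go-next (k + 2) 0 rest2 hd2
        | +-comm k 1 | +-comm k 2 = slide-pyramid-once Q j k (σ-tail 1 rest2)

DexStep-assoc : ∀ Q M X Y → DexStep ((Q ++ M) ++ X) ((Q ++ M) ++ Y) → DexStep (Q ++ M ++ X) (Q ++ M ++ Y)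
DexStep-assoc Q M X Y = subst₂ DexStep (++-assoc Q M X) (++-assoc Q M Y)

-- The sum of the letters; it strictly increases along our chains.
total : List ℕ → ℕ
total [] = 0
total (x ∷ r) = x + total r

total-mono : ∀ {u v} → u ≼ v → total u ≤ total v
total-mono [] = z≤n
total-mono (le ∷ p) = +-mono-≤ le (total-mono p)

Improvement : ℕ → ℕ → List ℕ → List ℕ → Set
Improvement cur p r r' = Σ (List ℕ) λ r'' → After p r'' × (r'' ≼ r') × (total r < total r'') × (length r'' ≡ length r) ×
  (∀ Q → DexStep (Q ++ true ∷ σ-go cur p r) (Q ++ true ∷ σ-go cur p r''))

Improvement-cons : ∀ {cur p cur' p'} x r r' (M : Word) →
  (∀ Z → σ-go cur p (x ∷ Z) ≡ M ++ true ∷ σ-go cur' p' Z) →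
  (∀ r'' → After p' r'' → After p (x ∷ r'')) →
  Improvement cur' p' r r' → Improvement cur p (x ∷ r) (x ∷ r')
Improvement-cons {cur} {p} {cur'} {p'} x r r' M draw after (r'' , g , r''≼r' , r<r'' , len , step) =
  x ∷ r'' , after r'' g , ≤-refl ∷ r''≼r' , +-monoʳ-< x r<r'' , cong suc len ,
  λ Q → subst₂ DexStep (sym (in-context Q r)) (sym (in-context Q r'')) (DexStep-assoc Q (true ∷ M) _ _ (step (Q ++ true ∷ M)))
  where
  in-context : ∀ Q Z → Q ++ true ∷ σ-go cur p (x ∷ Z) ≡ Q ++ (true ∷ M) ++ true ∷ σ-go cur' p' Z
  in-context Q Z = cong (λ z → Q ++ true ∷ z) (draw Z)

improve-here : ∀ cur p c c' r r' → p < cur → After p (c ∷ r) → After p (c' ∷ r') → c < c' → r ≼ r' →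
  Improvement cur p (c ∷ r) (c' ∷ r')
improve-here cur zero zero (suc (suc zero)) r r' p<cur g g' c<c' r≼r' =
  2 ∷ r , g , ≤-refl ∷ r≼r' , +-monoˡ-< (total r) (s≤s z≤n) , refl , λ Q → σ-step-raise Q cur 0 r p<cur g
improve-here cur (suc zero) zero (suc zero) r r' p<cur g g' c<c' r≼r' =
  1 ∷ r , After0⇒After1 r g , ≤-refl ∷ r≼r' , +-monoˡ-< (total r) (s≤s z≤n) , refl ,
  λ Q → DexStep-assoc Q (true ∷ zeros (cur ∸ 1)) _ _ (σ-step-0to1 (Q ++ true ∷ zeros (cur ∸ 1)) r g)
improve-here cur (suc zero) zero (suc (suc zero)) r r' p<cur g g' c<c' r≼r' =
  1 ∷ r , After0⇒After1 r g , s≤s z≤n ∷ r≼r' , +-monoˡ-< (total r) (s≤s z≤n) , refl ,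
  λ Q → DexStep-assoc Q (true ∷ zeros (cur ∸ 1)) _ _ (σ-step-0to1 (Q ++ true ∷ zeros (cur ∸ 1)) r g)
improve-here cur (suc zero) (suc zero) (suc (suc zero)) r r' p<cur g g' c<c' r≼r' =
  2 ∷ r , g , ≤-refl ∷ r≼r' , +-monoˡ-< (total r) (s≤s (s≤s z≤n)) , refl , λ Q → σ-step-raise Q cur 1 r p<cur g
improve-here cur zero zero (suc zero) r r' p<cur g () c<c' r≼r'
improve-here cur zero zero (suc (suc (suc _))) r r' p<cur g () c<c' r≼r'
improve-here cur zero (suc zero) c' r r' p<cur () g' c<c' r≼r'
improve-here cur zero (suc (suc zero)) (suc (suc zero)) r r' p<cur g g' (s≤s (s≤s ())) r≼r'
improve-here cur zero (suc (suc zero)) (suc (suc (suc _))) r r' p<cur g () c<c' r≼r'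
improve-here cur zero (suc (suc (suc _))) c' r r' p<cur () g' c<c' r≼r'
improve-here cur (suc zero) zero (suc (suc (suc _))) r r' p<cur g () c<c' r≼r'
improve-here cur (suc zero) (suc zero) (suc zero) r r' p<cur g g' (s≤s ()) r≼r'
improve-here cur (suc zero) (suc zero) (suc (suc (suc _))) r r' p<cur g () c<c' r≼r'
improve-here cur (suc zero) (suc (suc zero)) (suc (suc zero)) r r' p<cur g g' (s≤s (s≤s ())) r≼r'
improve-here cur (suc zero) (suc (suc zero)) (suc (suc (suc _))) r r' p<cur g () c<c' r≼r'
improve-here cur (suc zero) (suc (suc (suc _))) c' r r' p<cur () g' c<c' r≼r'
improve-here cur (suc (suc _)) c c' r r' p<cur () g' c<c' r≼r'
improve-here cur p c zero r r' p<cur g g' () r≼r'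

improve-go : ∀ cur p r r' → p < cur → After p r → After p r' → r ≼ r' → (r ≡ r' → ⊥) → Improvement cur p r r'
improve-go cur p [] [] p<cur g g' [] r≢r' = ⊥-elim (r≢r' refl)
improve-go cur p (c ∷ r) (c' ∷ r') p<cur g g' (c≤c' ∷ r≼r') r≢r' with c ≟ c'
... | no c≢c' = improve-here cur p c c' r r' p<cur g g' (≤∧≢⇒< c≤c' c≢c') r≼r'
... | yes refl = same p c p<cur g g'
  where
  tails-differ : r ≡ r' → ⊥
  tails-differ e = r≢r' (cong (c ∷_) e)
  same : ∀ p c → p < cur → After p (c ∷ r) → After p (c ∷ r') → Improvement cur p (c ∷ r) (c ∷ r')
  same zero zero p<cur g g' = Improvement-cons 0 r r' (zeros (cur ∸ 0)) (λ Z → refl) (λ _ g → g)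
    (improve-go 1 0 r r' (s≤s z≤n) g g' r≼r' tails-differ)
  same zero (suc (suc zero)) p<cur g g' = Improvement-cons 2 r r' [] (λ Z → refl) (λ _ g → g)
    (improve-go (suc cur) 0 r r' (m≤n⇒m≤1+n p<cur) g g' r≼r' tails-differ)
  same (suc zero) zero p<cur g g' = Improvement-cons 0 r r' (zeros (cur ∸ 1)) (λ Z → refl) (λ _ g → g)
    (improve-go 2 0 r r' (s≤s z≤n) g g' r≼r' tails-differ)
  same (suc zero) (suc zero) p<cur g g' = Improvement-cons 1 r r' (zeros (cur ∸ 1)) (λ Z → refl) (λ _ g → g)
    (improve-go 2 1 r r' (s≤s (s≤s z≤n)) g g' r≼r' tails-differ)
  same (suc zero) (suc (suc zero)) p<cur g g' = Improvement-cons 2 r r' [] (λ Z → refl) (λ _ g → g)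
    (improve-go (suc cur) 1 r r' (m≤n⇒m≤1+n p<cur) g g' r≼r' tails-differ)

IsTri-head : ∀ u → IsTri u → HeadAtMost1 u
IsTri-head (h ∷ r) g = inj₂ (h , r , refl , After-≤1 h r g)

σ-Dy-tri : ∀ n u → IsTri u → length u ≡ n → Dy (n + 2) (σ u)
σ-Dy-tri .(length u) u g refl = σ-Dy u (IsTri-head u g)

improve : ∀ u v → IsTri u → IsTri v → u ≼ v → (u ≡ v → ⊥) →
  Σ (List ℕ) λ w → IsTri w × (w ≼ v) × (total u < total w) × (length w ≡ length u) × DexStep (σ u) (σ w)
improve (h ∷ r) (h' ∷ r') g g' (h≤h' ∷ r≼r') u≢v with h ≟ h'
... | yes refl with improve-go 2 h r r' (s≤s (After-≤1 h r g)) g g' r≼r' (λ e → u≢v (cong (h ∷_) e))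
...   | r'' , g'' , r''≼r' , r<r'' , len , step =
  h ∷ r'' , g'' , ≤-refl ∷ r''≼r' , +-monoʳ-< h r<r'' , cong suc len , step (true ∷ [])
improve (h ∷ r) (h' ∷ r') g g' (h≤h' ∷ r≼r') u≢v | no h≢h' = change-head h h' g g' (≤∧≢⇒< h≤h' h≢h')
  where
  change-head : ∀ h h' → After h r → After h' r' → h < h' →
    Σ (List ℕ) λ w → IsTri w × (w ≼ (h' ∷ r')) × (total (h ∷ r) < total w) × (length w ≡ length (h ∷ r)) ×
      DexStep (σ (h ∷ r)) (σ w)
  change-head zero (suc zero) g g' h<h' = 1 ∷ r , After0⇒After1 r g , ≤-refl ∷ r≼r' , ≤-refl , refl , σ-step-0to1 (true ∷ []) r g
  change-head zero (suc (suc _)) g () h<h'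
  change-head (suc zero) (suc (suc _)) g () h<h'
  change-head (suc zero) (suc zero) g g' (s≤s ())
  change-head (suc (suc _)) h' () g' h<h'
  change-head h zero g g' ()

-- Iterating `improve`; the fuel bounds the number of steps by the gap in totals.
σ-chain : ∀ n fuel u v → total v ≤ fuel + total u → IsTri u → IsTri v → length u ≡ n → length v ≡ n → u ≼ v →
  DexLe (n + 2) (σ u) (σ v)
σ-chain n fuel u v gap gu gv lu lv u≼v with ≡-dec _≟_ u v
... | yes refl = ε
... | no u≢v with improve u v gu gv u≼v u≢v
... | w , gw , w≼v , u<w , lw , step with fuel
... | zero = ⊥-elim (1+n≰n (≤-trans u<w (≤-trans (total-mono w≼v) gap)))
... | suc f = (σ-Dy-tri n u gu lu , σ-Dy-tri n w gw (trans lw lu) , step) ◅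
              σ-chain n f w v (≤-trans gap (subst (_≤ f + total w) (+-suc f (total u)) (+-monoʳ-≤ f u<w)))
                gw gv (trans lw lu) lv w≼v

σ-monotone : ∀ n u v → IsTri u → IsTri v → length u ≡ n → length v ≡ n → u ≼ v → DexLe (n + 2) (σ u) (σ v)
σ-monotone n u v = σ-chain n (total v) u v (m≤m+n (total v) (total u))

σ-go-zeros : ∀ k → σ-go 1 0 (replicate k 0) ≡ false ∷ tens (suc k)
σ-go-zeros zero = refl
σ-go-zeros (suc k) = cong (λ z → false ∷ true ∷ z) (σ-go-zeros k)

σ-bottom : ∀ k → σ (replicate (suc k) 0) ≡ Fbot (suc k)
σ-bottom zero = refl
σ-bottom (suc k) = cong (λ z → true ∷ true ∷ false ∷ false ∷ true ∷ z) (σ-go-zeros k)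

σ-top : ∀ k → σ (1 ∷ twos k) ≡ Ftop (suc k)
σ-top k = cong (λ z → true ∷ true ∷ z)
  (trans (cong (σ-go 2 1) (sym (++-identityʳ (twos k))))
  (trans (σ-go-twos 2 1 k [])
   (cong (λ z → ones k ++ zeros (z ∸ 1) ++ true ∷ false ∷ false ∷ []) (+-comm k 2))))

After0-zeros : ∀ k → After0 (replicate k 0)
After0-zeros zero = tt
After0-zeros (suc k) = After0-zeros k

After1-twos : ∀ k → After1 (twos k)
After1-twos zero = tt
After1-twos (suc k) = After1-twos k

zeros-least : ∀ u → replicate (length u) 0 ≼ u
zeros-least [] = []
zeros-least (x ∷ u) = z≤n ∷ zeros-least u

top-greatest : ∀ h r → IsTri (h ∷ r) → (h ∷ r) ≼ (1 ∷ twos (length r))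
top-greatest h r g = After-≤1 h r g ∷ below-twos r (After-≤2 h r g)
  where
  below-twos : ∀ r → All (_≤ 2) r → r ≼ twos (length r)
  below-twos [] a = []
  below-twos (x ∷ r) (px ∷ a) = px ∷ below-twos r a

σ-in-F : ∀ k u → IsTri u → length u ≡ suc k → F (suc k) (σ u)
σ-in-F k u gu lu = σ-Dy-tri n u gu lu , from-bottom , to-top
  where
  n : ℕ
  n = suc k
  from-bottom : DexLe (n + 2) (Fbot n) (σ u)
  from-bottom = subst (λ z → DexLe (n + 2) z (σ u)) (σ-bottom k)
    (σ-monotone n (replicate n 0) u (After0-zeros k) gu (length-replicate n) lu
      (subst (λ z → replicate z 0 ≼ u) lu (zeros-least u)))
  below-top : ∀ u → IsTri u → length u ≡ n → u ≼ (1 ∷ twos k)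
  below-top (h ∷ r) g l = subst (λ z → (h ∷ r) ≼ (1 ∷ twos z)) (suc-injective l) (top-greatest h r g)
  to-top : DexLe (n + 2) (σ u) (Ftop n)
  to-top = subst (DexLe (n + 2) (σ u)) (σ-top k)
    (σ-monotone n u (1 ∷ twos k) gu (After1-twos k) lu (cong suc (length-replicate k)) (below-top u gu lu))

-- The shape of a dexter step d ⋖ e of a Dyck path d: the moved subpath is
-- 1 x′ with x′ going from height 1 down to 0 (ending with a 0), it starts
-- from a valley of height H, and H = 0 when nothing follows it.
record StepShape (d e : Word) : Set where
  constructor mkShape
  field
    p x′ s : Word
    α β′ H : ℕ
    x′-nonneg : Nonneg 1 x′
    x′-returns : height 1 x′ ≡ 0
    x′-ends-0 : lastLetter true x′ ≡ false
    s-ok : EmptyOrStartsWith1 s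
    valley : suc (height 0 p) ≡ H + (α + suc β′)
    d-shape : d ≡ p ++ true ∷ zeros (α + suc β′) ++ true ∷ (x′ ++ s)
    e-shape : e ≡ p ++ true ∷ zeros α ++ true ∷ (x′ ++ zeros (suc β′) ++ s)
    end-valley : s ≡ [] → H ≡ 0

-- A step moving the empty path changes nothing.
analyse-step : ∀ {d e} → DexStep d e → IsDyck d → (d ≡ e) ⊎ StepShape d e
analyse-step (p , [] , s , m , α , β , _ , _ , _ , _ , refl , _ , ed , ee) dd =
  inj₁ (trans ed (trans (cong (λ z → p ++ true ∷ z ++ s) (replicate-+ α β false))
         (trans (cong (λ z → p ++ true ∷ z) (++-assoc (zeros α) (zeros β) s)) (sym ee))))
analyse-step (p , false ∷ x′ , s , m , α , β , (_ , nnx) , _ , _ , _ , _ , _ , _ , _) dd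
  with Nonneg-down⁻ nnx
... | _ , () , _
analyse-step (p , true ∷ x′ , s , m , α , zero , _ , _ , _ , _ , _ , () , _ , _) dd
analyse-step {d} (p , true ∷ x′ , s , .(α + suc β′) , α , suc β′ , (bal , nnx) , _ , _ , s-ok , refl , _ , ed , ee) dd =
  inj₂ (mkShape p x′ s α β′ H nn1 returns ends-0 s-ok valley ed ee end-valley)
  where
  m : ℕ
  m = α + suc β′
  nn1 : Nonneg 1 x′
  nn1 = Nonneg-up⁻ nnx
  bal1 : #1 x′ + 1 ≡ #0 x′
  bal1 = trans (+-comm (#1 x′) 1) bal
  returns : height 1 x′ ≡ 0
  returns = +-cancelʳ-≡ (#0 x′) (height 1 x′) 0 (trans (height-exact 1 x′ nn1) (trans (+-comm 1 (#1 x′)) bal1))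
  ends-0 : lastLetter true x′ ≡ false
  ends-0 = lastLetter-descent true 1 x′ nn1 bal1 (inj₂ ≤-refl)
  after-p : Nonneg (suc (height 0 p)) (zeros m ++ true ∷ (x′ ++ s))
  after-p = Nonneg-up⁻ (Nonneg-suffix 0 p _ (subst (Nonneg 0) ed (proj₂ dd)))
  H : ℕ
  H = suc (height 0 p) ∸ m
  valley : suc (height 0 p) ≡ H + m
  valley = sym (m∸n+n≡m (Nonneg-zeros⁻ _ m _ after-p))
  end-valley : s ≡ [] → H ≡ 0
  end-valley refl = trans (sym final-height) (trans (cong (height 0) (sym ed)) (height-Dyck d dd))
    where
    open ≡-Reasoning
    final-height : height 0 (p ++ true ∷ zeros m ++ true ∷ (x′ ++ [])) ≡ H
    final-height = begin
      height 0 (p ++ true ∷ zeros m ++ true ∷ (x′ ++ []))  ≡⟨ height-++ 0 p _ ⟩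
      height (suc (height 0 p)) (zeros m ++ true ∷ (x′ ++ [])) ≡⟨ height-zeros (suc (height 0 p)) m _ ⟩
      height (suc H) (x′ ++ [])                              ≡⟨ cong (height (suc H)) (++-identityʳ x′) ⟩
      height (1 + H) x′                                      ≡⟨ height-shift 1 H x′ nn1 ⟩
      height 1 x′ + H                                        ≡⟨ cong (_+ H) returns ⟩
      H                                                      ∎

-- Paths of F(n) start with 11: this holds for Fbot and dexter steps keep
-- the first two letters (a step never changes the first letter, and the
-- second one can only become a 1).
StartsWith11 : Word → Set
StartsWith11 d = Σ Word λ w → d ≡ true ∷ true ∷ w

StartsWith11-up : ∀ {d e} → DexStep d e → StartsWith11 d → StartsWith11 e
StartsWith11-up ([] , x , s , suc m , α , β , _ , _ , _ , _ , _ , _ , ed , ee) (w , refl) with ed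
... | ()
StartsWith11-up ((b ∷ []) , x , s , m , α , β , _ , _ , _ , _ , _ , _ , ed , refl) (w , refl) with ed
... | refl = _ , refl
StartsWith11-up ((b ∷ b' ∷ p) , x , s , m , α , β , _ , _ , _ , _ , _ , _ , ed , refl) (w , refl) with ed
... | refl = _ , refl

No01 : List ℕ → Set
No01 [] = ⊤
No01 (x ∷ r) = (x ≡ 0 → All (_≢ 1) r) × No01 r

HasZero : List ℕ → Set
HasZero = Any (_≡ 0)

No01-++⁻ : ∀ a b → No01 (a ++ b) → No01 a × No01 b × (HasZero a → All (_≢ 1) b)
No01-++⁻ [] b nb = tt , nb , λ ()
No01-++⁻ (x ∷ a) b (f , nb) with No01-++⁻ a b nb
... | na , nb' , h = ((λ x≡0 → ++⁻ˡ a (f x≡0)) , na) , nb' , zero-in-front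
  where
  zero-in-front : HasZero (x ∷ a) → All (_≢ 1) b
  zero-in-front (here x≡0) = ++⁻ʳ a (f x≡0)
  zero-in-front (there z) = h z

No01-++⁺ : ∀ a b → No01 a → No01 b → (HasZero a → All (_≢ 1) b) → No01 (a ++ b)
No01-++⁺ [] b na nb h = nb
No01-++⁺ (x ∷ a) b (f , na) nb h =
  (λ x≡0 → ++⁺ (f x≡0) (h (here x≡0))) , No01-++⁺ a b na nb (λ z → h (there z))

zeros-≢1 : ∀ {l} → All (_≡ 0) l → All (_≢ 1) l
zeros-≢1 [] = []
zeros-≢1 (refl ∷ a) = (λ ()) ∷ zeros-≢1 a

zeros-≤1 : ∀ {l} → All (_≡ 0) l → All (_≤ 1) l
zeros-≤1 [] = []
zeros-≤1 (refl ∷ a) = z≤n ∷ zeros-≤1 a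

No01-zeros : ∀ l → All (_≡ 0) l → No01 l
No01-zeros [] a = tt
No01-zeros (x ∷ l) (px ∷ a) = (λ _ → zeros-≢1 a) , No01-zeros l a

FirstValley : ℕ → List ℕ → Set
FirstValley H S = ((S ≡ []) × (H ≡ 0)) ⊎ (Σ (List ℕ) λ S' → S ≡ H ∷ S')

raised-valleys : ∀ H β V → 1 ≤ β → All (_≤ 1) (map (_+ (H + β)) V) →
  All (_≡ 0) (map (_+ H) V) × ((V ≡ []) ⊎ (H ≡ 0))
raised-valleys H β [] 1≤β a = [] , inj₁ refl
raised-valleys H β (v ∷ V) 1≤β (v≤1 ∷ a) = (v+H≡0 ∷ proj₁ (raised-valleys H β V 1≤β a)) , inj₂ H≡0
  where
  open ≤-Reasoning
  v+H≡0 : v + H ≡ 0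
  v+H≡0 = n≤0⇒n≡0 (≤-pred (begin
    suc (v + H)     ≡⟨ +-comm 1 (v + H) ⟩
    v + H + 1       ≤⟨ +-monoʳ-≤ (v + H) 1≤β ⟩
    v + H + β       ≡⟨ +-assoc v H β ⟩
    v + (H + β)     ≤⟨ v≤1 ⟩
    1               ∎))
  H≡0 : H ≡ 0
  H≡0 = n≤0⇒n≡0 (subst (H ≤_) v+H≡0 (m≤n+m H v))

≤1-moved : ∀ VP E H β V S → 1 ≤ β → FirstValley H S → All (_≤ 1) (VP ++ E ++ (map (_+ (H + β)) V ++ S)) →
  All (_≤ 1) (VP ++ H ∷ (map (_+ H) V ++ S))
≤1-moved VP E H β V S 1≤β first a = ++⁺ (++⁻ˡ VP a) (H≤1 first aS ∷ ++⁺ (zeros-≤1 (proj₁ raised)) aS)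
  where
  aR : All (_≤ 1) (map (_+ (H + β)) V ++ S)
  aR = ++⁻ʳ E (++⁻ʳ VP a)
  aS : All (_≤ 1) S
  aS = ++⁻ʳ (map (_+ (H + β)) V) aR
  raised : All (_≡ 0) (map (_+ H) V) × ((V ≡ []) ⊎ (H ≡ 0))
  raised = raised-valleys H β V 1≤β (++⁻ˡ (map (_+ (H + β)) V) aR)
  H≤1 : ∀ {S} → FirstValley H S → All (_≤ 1) S → H ≤ 1
  H≤1 (inj₁ (_ , refl)) _ = z≤n
  H≤1 (inj₂ (S' , refl)) (H≤1 ∷ _) = H≤1

No01-moved : ∀ VP E H β V S → 1 ≤ β → FirstValley H S → All (_≤ 1) (VP ++ E ++ (map (_+ (H + β)) V ++ S)) →
  No01 (VP ++ E ++ (map (_+ (H + β)) V ++ S)) → No01 (VP ++ H ∷ (map (_+ H) V ++ S))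
No01-moved VP E H β V S 1≤β first a n01 = No01-++⁺ VP (H ∷ (Vz ++ S)) nVP n-rest zero-in-VP
  where
  Vr Vz : List ℕ
  Vr = map (_+ (H + β)) V
  Vz = map (_+ H) V
  split-VP : No01 VP × No01 (E ++ (Vr ++ S)) × (HasZero VP → All (_≢ 1) (E ++ (Vr ++ S)))
  split-VP = No01-++⁻ VP (E ++ (Vr ++ S)) n01
  nVP : No01 VP
  nVP = proj₁ split-VP
  nS : No01 S
  nS = proj₁ (proj₂ (No01-++⁻ Vr S (proj₁ (proj₂ (No01-++⁻ E (Vr ++ S) (proj₁ (proj₂ split-VP)))))))
  raised : All (_≡ 0) Vz × ((V ≡ []) ⊎ (H ≡ 0))
  raised = raised-valleys H β V 1≤β (++⁻ˡ Vr (++⁻ʳ E (++⁻ʳ VP a)))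
  S-after-VP : HasZero VP → All (_≢ 1) S
  S-after-VP z = ++⁻ʳ Vr (++⁻ʳ E (proj₂ (proj₂ split-VP) z))
  S-after-H : H ≡ 0 → All (_≢ 1) S
  S-after-H H≡0 = go first nS
    where
    go : ∀ {S} → FirstValley H S → No01 S → All (_≢ 1) S
    go (inj₁ (refl , _)) _ = []
    go (inj₂ (S' , refl)) nS = subst (_≢ 1) (sym H≡0) (λ ()) ∷ proj₁ nS H≡0
  H-after-VP : HasZero VP → H ≢ 1
  H-after-VP z = go first (S-after-VP z)
    where
    go : ∀ {S} → FirstValley H S → All (_≢ 1) S → H ≢ 1
    go (inj₁ (_ , refl)) _ = λ ()
    go (inj₂ (S' , refl)) (H≢1 ∷ _) = H≢1
  zero-in-Vz : HasZero Vz → H ≡ 0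
  zero-in-Vz z with proj₂ raised
  ... | inj₂ H≡0 = H≡0
  zero-in-Vz () | inj₁ refl
  n-rest : No01 (H ∷ (Vz ++ S))
  n-rest = (λ H≡0 → ++⁺ (zeros-≢1 (proj₁ raised)) (S-after-H H≡0)) ,
           No01-++⁺ Vz S (No01-zeros Vz (proj₁ raised)) nS (λ z → S-after-H (zero-in-Vz z))
  zero-in-VP : HasZero VP → All (_≢ 1) (H ∷ (Vz ++ S))
  zero-in-VP z = H-after-VP z ∷ ++⁺ (zeros-≢1 (proj₁ raised)) (S-after-VP z)

valleyIf : Bool → ℕ → List ℕ
valleyIf true h = []
valleyIf false h = h ∷ []

flushIf : Bool → ℕ → ℕ → List ℕ
flushIf true h n = []
flushIf false h n = h ∷ replicate n 2

pending-after : Bool → ℕ → ℕ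
pending-after true n = suc n
pending-after false n = 0

valleys-up : ∀ b h R → valleys b h (true ∷ R) ≡ valleyIf b h ++ valleys true (suc h) R
valleys-up true h R = refl
valleys-up false h R = refl

ρ-flush-up : ∀ b h n R → ρ-flush b h n (true ∷ R) ≡ flushIf b h n ++ ρ-flush true (suc h) (pending-after b n) R
ρ-flush-up true h n R = refl
ρ-flush-up false h n R = refl

pending-up : ∀ b n R → pending b n (true ∷ R) ≡ pending true (pending-after b n) R
pending-up true n R = refl
pending-up false n R = refl

valleys-before-up : ∀ p R → valleys true 0 (p ++ true ∷ R) ≡
  (valleys true 0 p ++ valleyIf (lastLetter true p) (height 0 p)) ++ valleys true (suc (height 0 p)) R
valleys-before-up p R = trans (valleys-++ true 0 p (true ∷ R))
  (trans (cong (valleys true 0 p ++_) (valleys-up (lastLetter true p) (height 0 p) R))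
         (sym (++-assoc (valleys true 0 p) _ _)))

ρ-flush-before-up : ∀ p R → ρ-flush true 0 0 (p ++ true ∷ R) ≡
  (ρ-go true 0 0 p ++ flushIf (lastLetter true p) (height 0 p) (pending true 0 p)) ++
    ρ-flush true (suc (height 0 p)) (pending-after (lastLetter true p) (pending true 0 p)) R
ρ-flush-before-up p R = trans (ρ-flush-++ true 0 0 p (true ∷ R))
  (trans (cong (ρ-go true 0 0 p ++_) (ρ-flush-up (lastLetter true p) (height 0 p) (pending true 0 p) R))
         (sym (++-assoc (ρ-go true 0 0 p) _ _)))

pending-before-up : ∀ p R → pending true 0 (p ++ true ∷ R) ≡ pending true (pending-after (lastLetter true p) (pending true 0 p)) R
pending-before-up p R = trans (pending-++ true 0 p (true ∷ R)) (pending-up (lastLetter true p) (pending true 0 p) R)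

pending-descend : ∀ b N m W → 0 < m → pending b N (zeros m ++ W) ≡ pending false N W
pending-descend b N (suc k) W _ = pending-zeros b N k W

HeadAtLeast : ℕ → List ℕ → Set
HeadAtLeast L l = (l ≡ []) ⊎ (Σ ℕ λ q → Σ (List ℕ) λ l' → (l ≡ q ∷ l') × L ≤ q)

HeadAtLeast-++ : ∀ {L} A B → All (L ≤_) A → HeadAtLeast L B → HeadAtLeast L (A ++ B)
HeadAtLeast-++ [] B a h = h
HeadAtLeast-++ (x ∷ A) B (px ∷ a) h = inj₂ (x , _ , refl , px)

insert-dominates : ∀ H N P Q → P ≼ Q → H ≤ 2 → All (_≤ 2) P → HeadAtLeast H Q →
  (H ∷ (replicate N 2 ++ P)) ≼ insert2s (suc N) Q
insert-dominates H N [] [] [] H≤2 aP hQ =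
  H≤2 ∷ subst (_≼ replicate N 2) (sym (++-identityʳ (replicate N 2))) (≼-refl _)
insert-dominates H N (p ∷ P) (q ∷ Q) (p≤q ∷ P≼Q) H≤2 (p≤2 ∷ aP) (inj₁ ())
insert-dominates H N (p ∷ P) (q ∷ Q) (p≤q ∷ P≼Q) H≤2 (p≤2 ∷ aP) (inj₂ (.q , .Q , refl , H≤q)) =
  H≤q ∷ subst ((replicate N 2 ++ p ∷ P) ≼_) (sym (replicate-slide N 2 Q)) (≼-++ (≼-refl (replicate N 2)) (p≤2 ∷ P≼Q))

0<α+suc : ∀ α β′ → 0 < α + suc β′
0<α+suc α β′ = subst (0 <_) (sym (+-suc α β′)) (s≤s z≤n)

reshuffle : ∀ H α β → H + (suc α + β) ≡ (H + β) + suc α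
reshuffle = solve-∀

-- The valley created in front of the moved subpath when α > 0.
leadValley : ℕ → ℕ → List ℕ
leadValley zero v = []
leadValley (suc _) v = v ∷ []

-- Here d = p 1 0^(α+β) 1 x′ s and e = p 1 0^α 1 x′ 0^β s: the moved
-- subpath starts from a valley of height H in d and of height H + β in e.
module StepAnalysis {d e : Word} (sh : StepShape d e) where
  open StepShape sh

  β : ℕ
  β = suc β′

  h₀ : ℕ
  h₀ = height 0 p

  -- Valleys before the moved subpath, inside it (relative to its base),
  -- and after it.
  VP V S : List ℕ
  VP = valleys true 0 p ++ valleyIf (lastLetter true p) h₀
  V = valleys true 1 x′
  S = valleys false H s

  first-valley : FirstValley H S
  first-valley = go s s-ok end-valley
    where
    go : ∀ s → EmptyOrStartsWith1 s → (s ≡ [] → H ≡ 0) → FirstValley H (valleys false H s)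
    go .[] (inj₁ refl) H≡0 = inj₁ (refl , H≡0 refl)
    go .(true ∷ s') (inj₂ (s' , refl)) _ = inj₂ (_ , refl)

  valleys-through : ∀ K Y → valleys true (suc K) (x′ ++ Y) ≡ map (_+ K) V ++ valleys false K Y
  valleys-through K Y = trans (valleys-++ true (suc K) x′ Y)
    (cong₂ _++_ (valleys-shift true 1 K x′ x′-nonneg)
      (cong₂ (λ a b → valleys a b Y) x′-ends-0 (trans (height-shift 1 K x′ x′-nonneg) (cong (_+ K) x′-returns))))

  valleys-d : valleys true 0 d ≡ VP ++ H ∷ (map (_+ H) V ++ S)
  valleys-d = begin
    valleys true 0 d
      ≡⟨ cong (valleys true 0) d-shape ⟩
    valleys true 0 (p ++ true ∷ zeros (α + β) ++ true ∷ (x′ ++ s))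
      ≡⟨ valleys-before-up p _ ⟩
    VP ++ valleys true (suc h₀) (zeros (α + β) ++ true ∷ (x′ ++ s))
      ≡⟨ cong (λ z → VP ++ valleys true z (zeros (α + β) ++ true ∷ (x′ ++ s))) valley ⟩
    VP ++ valleys true (H + (α + β)) (zeros (α + β) ++ true ∷ (x′ ++ s))
      ≡⟨ cong (VP ++_) (valleys-descend true H (α + β) _ (0<α+suc α β′)) ⟩
    VP ++ H ∷ valleys true (suc H) (x′ ++ s)
      ≡⟨ cong (λ z → VP ++ H ∷ z) (valleys-through H s) ⟩
    VP ++ H ∷ (map (_+ H) V ++ S) ∎
    where open ≡-Reasoning

  valleys-e-tail : valleys true (suc (H + β)) (x′ ++ zeros β ++ s) ≡ map (_+ (H + β)) V ++ S
  valleys-e-tail = trans (valleys-through (H + β) _) (cong (map (_+ (H + β)) V ++_) (valleys-descend₀ H β s))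

  valleys-e-from : ∀ a → suc h₀ ≡ H + (a + β) →
    valleys true (suc h₀) (zeros a ++ true ∷ (x′ ++ zeros β ++ s)) ≡ leadValley a (H + β) ++ (map (_+ (H + β)) V ++ S)
  valleys-e-from zero eq = trans (cong (λ z → valleys true z (true ∷ (x′ ++ zeros β ++ s))) eq) valleys-e-tail
  valleys-e-from (suc a) eq =
    trans (cong (λ z → valleys true z (zeros (suc a) ++ true ∷ (x′ ++ zeros β ++ s))) (trans eq (reshuffle H a β)))
          (trans (valleys-descend true (H + β) (suc a) _ (s≤s z≤n)) (cong ((H + β) ∷_) valleys-e-tail))

  valleys-e : valleys true 0 e ≡ VP ++ leadValley α (H + β) ++ (map (_+ (H + β)) V ++ S)
  valleys-e = trans (cong (valleys true 0) e-shape) (trans (valleys-before-up p _) (cong (VP ++_) (valleys-e-from α valley)))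

  -- The counter N₂ when the moved subpath is reached.
  Nc : ℕ
  Nc = pending-after (lastLetter true p) (pending true 0 p)

  pending-through : ∀ n Y → pending true n (x′ ++ Y) ≡ pending false (pending true n x′) Y
  pending-through n Y = trans (pending-++ true n x′ Y) (cong (λ z → pending z (pending true n x′) Y) x′-ends-0)

  pending-d : pending true 0 d ≡ pending false (pending true 0 x′) s
  pending-d = trans (cong (pending true 0) d-shape) (trans (pending-before-up p _)
    (trans (pending-descend true Nc (α + β) _ (0<α+suc α β′)) (pending-through 0 s)))

  pending-e-from : ∀ a → pending false (pending true 0 x′) s ≤ pending true Nc (zeros a ++ true ∷ (x′ ++ zeros β ++ s))
  pending-e-from zero =
    subst (pending false (pending true 0 x′) s ≤_) (sym (trans (pending-through (suc Nc) _) (pending-zeros₀ _ β s)))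
      (pending-mono false _ _ s (pending-mono true 0 (suc Nc) x′ z≤n))
  pending-e-from (suc a) = ≤-reflexive (sym (trans (pending-descend true Nc (suc a) _ (s≤s z≤n))
    (trans (pending-through 0 _) (pending-zeros₀ _ β s))))

  pending-grows : pending true 0 d ≤ pending true 0 e
  pending-grows = subst₂ _≤_ (sym pending-d) (sym (trans (cong (pending true 0) e-shape) (pending-before-up p _)))
    (pending-e-from α)

  -- The output of ρ (with the final flush) before the moved subpath, and
  -- the parts P, Q read from its base in d and in e.
  Pre P Q : List ℕ
  Pre = ρ-go true 0 0 p ++ flushIf (lastLetter true p) h₀ (pending true 0 p)
  P = ρ-go true (suc H) 0 x′ ++ ρ-flush false H (pending true 0 x′) s
  Q = ρ-go true (suc (H + β)) 0 x′ ++ ρ-flush false H (pending true 0 x′) s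

  P≼Q : P ≼ Q
  P≼Q = ≼-++ (ρ-go-mono true (suc H) (suc (H + β)) 0 x′ (s≤s (m≤m+n H β))) (≼-refl _)

  flush-through : ∀ K Y → ρ-flush true (suc K) 0 (x′ ++ Y) ≡ ρ-go true (suc K) 0 x′ ++ ρ-flush false K (pending true 0 x′) Y
  flush-through K Y = trans (ρ-flush-++ true (suc K) 0 x′ Y)
    (cong (ρ-go true (suc K) 0 x′ ++_)
      (cong₂ (λ a b → ρ-flush a b (pending true 0 x′) Y) x′-ends-0 (trans (height-shift 1 K x′ x′-nonneg) (cong (_+ K) x′-returns))))

  flush-d : ρ-flush true 0 0 d ≡ Pre ++ H ∷ (replicate Nc 2 ++ P)
  flush-d = begin
    ρ-flush true 0 0 d
      ≡⟨ cong (ρ-flush true 0 0) d-shape ⟩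
    ρ-flush true 0 0 (p ++ true ∷ zeros (α + β) ++ true ∷ (x′ ++ s))
      ≡⟨ ρ-flush-before-up p _ ⟩
    Pre ++ ρ-flush true (suc h₀) Nc (zeros (α + β) ++ true ∷ (x′ ++ s))
      ≡⟨ cong (λ z → Pre ++ ρ-flush true z Nc (zeros (α + β) ++ true ∷ (x′ ++ s))) valley ⟩
    Pre ++ ρ-flush true (H + (α + β)) Nc (zeros (α + β) ++ true ∷ (x′ ++ s))
      ≡⟨ cong (Pre ++_) (ρ-flush-descend true H Nc (α + β) _ (0<α+suc α β′)) ⟩
    Pre ++ H ∷ (replicate Nc 2 ++ ρ-flush true (suc H) 0 (x′ ++ s))
      ≡⟨ cong (λ z → Pre ++ H ∷ (replicate Nc 2 ++ z)) (flush-through H s) ⟩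
    Pre ++ H ∷ (replicate Nc 2 ++ P) ∎
    where open ≡-Reasoning

  -- What ρ outputs in e from the valley before the moved subpath on.
  flushTail : ℕ → List ℕ
  flushTail zero = insert2s (suc Nc) Q
  flushTail (suc _) = (H + β) ∷ (replicate Nc 2 ++ Q)

  flush-e-tail : ρ-flush true (suc (H + β)) 0 (x′ ++ zeros β ++ s) ≡ Q
  flush-e-tail = trans (flush-through (H + β) _) (cong (ρ-go true (suc (H + β)) 0 x′ ++_) (ρ-flush-descend₀ H _ β s))

  flush-e-from : ∀ a → suc h₀ ≡ H + (a + β) → ρ-flush true (suc h₀) Nc (zeros a ++ true ∷ (x′ ++ zeros β ++ s)) ≡ flushTail a
  flush-e-from zero eq =
    trans (cong (λ z → ρ-flush true (suc z) (suc Nc) (x′ ++ zeros β ++ s)) eq)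
    (trans (cong (λ z → ρ-flush true (suc (H + β)) z (x′ ++ zeros β ++ s)) (sym (+-identityʳ (suc Nc))))
    (trans (ρ-flush-insert true (suc (H + β)) (suc Nc) 0 (x′ ++ zeros β ++ s)) (cong (insert2s (suc Nc)) flush-e-tail)))
  flush-e-from (suc a) eq =
    trans (cong (λ z → ρ-flush true z Nc (zeros (suc a) ++ true ∷ (x′ ++ zeros β ++ s))) (trans eq (reshuffle H a β)))
    (trans (ρ-flush-descend true (H + β) Nc (suc a) _ (s≤s z≤n))
           (cong (λ z → (H + β) ∷ (replicate Nc 2 ++ z)) flush-e-tail))

  flush-e : ρ-flush true 0 0 e ≡ Pre ++ flushTail α
  flush-e = trans (cong (ρ-flush true 0 0) e-shape) (trans (ρ-flush-before-up p _) (cong (Pre ++_) (flush-e-from α valley)))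

  after-subpath : H ≤ 2 → HeadAtLeast H (ρ-flush false H (pending true 0 x′) s)
  after-subpath H≤2 = go s s-ok
    where
    twos-head : ∀ c → HeadAtLeast H (replicate c 2)
    twos-head zero = inj₁ refl
    twos-head (suc c) = inj₂ (2 , _ , refl , H≤2)
    go : ∀ s → EmptyOrStartsWith1 s → HeadAtLeast H (ρ-flush false H (pending true 0 x′) s)
    go .[] (inj₁ refl) = twos-head (pending true 0 x′)
    go .(true ∷ s') (inj₂ (s' , refl)) = inj₂ (H , _ , refl , ≤-refl)

  tail-grows : ∀ a → All (_≤ 2) (H ∷ (replicate Nc 2 ++ P)) → (H ∷ (replicate Nc 2 ++ P)) ≼ flushTail a
  tail-grows zero (H≤2 ∷ rest) =
    insert-dominates H Nc P Q P≼Q H≤2 (++⁻ʳ (replicate Nc 2) rest)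
      (HeadAtLeast-++ (ρ-go true (suc (H + β)) 0 x′) _ subpath-high (after-subpath H≤2))
    where
    subpath-high : All (H ≤_) (ρ-go true (suc (H + β)) 0 x′)
    subpath-high = subst (λ z → All (H ≤_) (ρ-go true z 0 x′)) (cong suc (+-comm β H))
      (ρ-go-lower true (suc β) H 0 x′ (Nonneg-mono (s≤s z≤n) x′-nonneg) H≤2)
  tail-grows (suc a) _ = m≤m+n H β ∷ ≼-++ (≼-refl (replicate Nc 2)) P≼Q

  TopInvariant-moved : All (_≤ 1) (valleys true 0 e) → pending true 0 e ≡ 0 → No01 (valleys true 0 e) →
    All (_≤ 1) (valleys true 0 d) × (pending true 0 d ≡ 0) × No01 (valleys true 0 d)
  TopInvariant-moved ≤1 pend n01 =
    subst (All (_≤ 1)) (sym valleys-d) (≤1-moved VP (leadValley α (H + β)) H β V S (s≤s z≤n) first-valley ≤1e) ,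
    n≤0⇒n≡0 (subst (pending true 0 d ≤_) pend pending-grows) ,
    subst No01 (sym valleys-d) (No01-moved VP (leadValley α (H + β)) H β V S (s≤s z≤n) first-valley ≤1e (subst No01 valleys-e n01))
    where
    ≤1e : All (_≤ 1) (VP ++ leadValley α (H + β) ++ (map (_+ (H + β)) V ++ S))
    ≤1e = subst (All (_≤ 1)) valleys-e ≤1

  flush-grows : All (_≤ 2) (ρ-flush true 0 0 d) → ρ-flush true 0 0 d ≼ ρ-flush true 0 0 e
  flush-grows ≤2 = subst₂ _≼_ (sym flush-d) (sym flush-e)
    (≼-++ (≼-refl Pre) (tail-grows α (++⁻ʳ Pre (subst (All (_≤ 2)) flush-d ≤2))))

-- Paths of F(n) have valleys of height ≤ 1, no pending 2s at the end and no
-- valley 1 after a valley 0: this holds for Ftop and is inherited along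
-- dexter steps downwards.
TopInvariant : Word → Set
TopInvariant d = All (_≤ 1) (valleys true 0 d) × (pending true 0 d ≡ 0) × No01 (valleys true 0 d)

TopInvariant-down : ∀ {d e} → IsDyck d → DexStep d e → TopInvariant e → TopInvariant d
TopInvariant-down dd step (≤1 , pend , n01) with analyse-step step dd
... | inj₁ refl = ≤1 , pend , n01
... | inj₂ sh = StepAnalysis.TopInvariant-moved sh ≤1 pend n01

-- Ftop (n) = 1 1ⁿ 0ⁿ 1 0 0 has the single valley 1 and no pending 2s.
TopInvariant-Ftop : ∀ k → TopInvariant (Ftop (suc k))
TopInvariant-Ftop k = subst (All (_≤ 1)) (sym single-valley) (s≤s z≤n ∷ []) , no-pending , subst No01 (sym single-valley) ((λ ()) , tt)
  where
  T : Word
  T = true ∷ false ∷ false ∷ []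
  descent : ∀ k → (k + 2) ∸ suc k ≡ 1
  descent zero = refl
  descent (suc k) = descent k
  single-valley : valleys true 0 (Ftop (suc k)) ≡ 1 ∷ []
  single-valley = trans (valleys-ones 2 k (zeros (suc k) ++ T))
    (trans (valleys-zeros true (k + 2) k T) (cong (λ z → z ∷ []) (descent k)))
  no-pending : pending true 0 (Ftop (suc k)) ≡ 0
  no-pending = trans (pending-ones 2 k (zeros (suc k) ++ T)) (pending-zeros true (k + 2) k T)

step-flush-mono : ∀ {d e} → IsDyck d → DexStep d e → All (_≤ 2) (ρ-flush true 0 0 d) → ρ-flush true 0 0 d ≼ ρ-flush true 0 0 e
step-flush-mono dd step ≤2 with analyse-step step dd
... | inj₁ refl = ≼-refl _
... | inj₂ sh = StepAnalysis.flush-grows sh ≤2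

-- For a path 11w without pending 2s, the flushed output is ρ with the two
-- 2s counted for the initial 11 inserted.
ρ-via-flush : ∀ w → pending true 2 w ≡ 0 → ρ-flush true 0 0 (true ∷ true ∷ w) ≡ insert2s 2 (ρ (true ∷ true ∷ w))
ρ-via-flush w no-pending =
  trans (ρ-flush-insert true 2 2 0 w) (cong (insert2s 2) (trans (ρ-flush-split true 2 0 w)
    (trans (cong (λ z → ρ-go true 2 0 w ++ replicate z 2) pending≡0) (++-identityʳ _))))
  where
  pending≡0 : pending true 0 w ≡ 0
  pending≡0 = n≤0⇒n≡0 (subst (pending true 0 w ≤_) no-pending (pending-mono true 0 2 w z≤n))

insert2s-cancel : ∀ X Y → insert2s 2 X ≼ insert2s 2 Y → X ≼ Y
insert2s-cancel [] [] _ = []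
insert2s-cancel (x ∷ X) (y ∷ Y) (x≤y ∷ _ ∷ _ ∷ X≼Y) = x≤y ∷ X≼Y
insert2s-cancel [] (y ∷ Y) (_ ∷ _ ∷ ())
insert2s-cancel (x ∷ X) [] (_ ∷ _ ∷ ())

≤1⇒≤2 : ∀ {l} → All (_≤ 1) l → All (_≤ 2) l
≤1⇒≤2 [] = []
≤1⇒≤2 (p ∷ a) = ≤-trans p (s≤s z≤n) ∷ ≤1⇒≤2 a

ρ-step-mono : ∀ {d e} → IsDyck d → DexStep d e → StartsWith11 d → TopInvariant d → TopInvariant e → ρ d ≼ ρ e
ρ-step-mono {d} dd step (w , refl) (≤1 , pend , _) (_ , pend' , _) with StartsWith11-up step (w , refl)
... | w' , refl =
  insert2s-cancel _ _ (subst₂ _≼_ (ρ-via-flush w pend) (ρ-via-flush w' pend')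
    (step-flush-mono dd step (ρ-flush-≤2 true 0 0 d (≤1⇒≤2 ≤1))))

data ZeroRun : Word → Set where
  only-zeros : ∀ k → ZeroRun (zeros k)
  zeros-then-1 : ∀ k w → ZeroRun (zeros k ++ true ∷ w)

zero-run : ∀ w → ZeroRun w
zero-run [] = only-zeros 0
zero-run (true ∷ w) = zeros-then-1 0 w
zero-run (false ∷ w) with zero-run w
... | only-zeros k = only-zeros (suc k)
... | zeros-then-1 k w' = zeros-then-1 (suc k) w'

data Blocks : Word → Set where
  final : ∀ N k → Blocks (ones N ++ zeros k)
  valley : ∀ N k w → Blocks (ones N ++ zeros (suc k) ++ true ∷ w)

blocks : ∀ w → Blocks w
blocks [] = final 0 0
blocks (true ∷ w) with blocks w
... | final N k = final (suc N) k
... | valley N k w' = valley (suc N) k w'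
blocks (false ∷ w) with zero-run w
... | only-zeros k = final 0 (suc k)
... | zeros-then-1 k w' = valley 0 k w'

Decoded : ℕ → Word → Set
Decoded c w = (w ≡ σ-tail c (ρ-go true c 0 w)) × (No01 (valleys true c w) → After1 (ρ-go true c 0 w)) ×
  (All (_≡ 0) (valleys true c w) → After0 (ρ-go true c 0 w)) × HeadAtMost1 (ρ-go true c 0 w)

pending-zeros-only : ∀ b n k → pending b n (zeros k) ≡ n
pending-zeros-only b n zero = refl
pending-zeros-only b n (suc k) = pending-zeros-only false n k

pending-final : ∀ N k → pending true 0 (ones N ++ zeros k) ≡ N
pending-final N k = trans (pending-ones 0 N (zeros k)) (trans (pending-zeros-only true (N + 0) k) (+-identityʳ N))

-- A final block 1ᴺ 0ᵏ without pending 2s is just the descent 0ᶜ.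
decode-final : ∀ c N k → Descends c (ones N ++ zeros k) → pending true 0 (ones N ++ zeros k) ≡ 0 →
  Decoded c (ones N ++ zeros k)
decode-final c N k (_ , bal) pend with trans (sym (pending-final N k)) pend
... | refl = trans (cong zeros k≡c) (cong (σ-tail c) (sym ρ-empty)) ,
             (λ _ → subst After1 (sym ρ-empty) tt) , (λ _ → subst After0 (sym ρ-empty) tt) , subst HeadAtMost1 (sym ρ-empty) (inj₁ refl)
  where
  ρ-empty : ρ-go true c 0 (zeros k) ≡ []
  ρ-empty = ρ-go-zeros-only c 0 k
  k≡c : k ≡ c
  k≡c = trans (sym (#0-zeros k)) (trans (sym bal) (cong (_+ c) (#1-zeros k)))

blockValley : ℕ → ℕ → ℕ → ℕ
blockValley c N k = N + c ∸ suc k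

height-zeros-only : ∀ h k → height h (zeros k) ≡ h ∸ k
height-zeros-only h k = trans (cong (height h) (sym (++-identityʳ (zeros k)))) (height-zeros h k [])

record BlockReading (c N k : ℕ) (w : Word) : Set where
  field
    descent-fits : suc k ≤ N + c
    rest-descends : Descends (suc (blockValley c N k)) w
    ρ-block : ρ-go true c 0 (ones N ++ zeros (suc k) ++ true ∷ w) ≡ blockValley c N k ∷ (twos N ++ ρ-go true (suc (blockValley c N k)) 0 w)
    valleys-block : valleys true c (ones N ++ zeros (suc k) ++ true ∷ w) ≡ blockValley c N k ∷ valleys true (suc (blockValley c N k)) w
    pending-block : pending true 0 (ones N ++ zeros (suc k) ++ true ∷ w) ≡ pending true 0 w

balance-rest : ∀ N a c k b h → N + c ≡ h + k → (N + suc a) + c ≡ k + b → a + suc h ≡ b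
balance-rest N a c k b h block total = +-cancelʳ-≡ k (a + suc h) b (begin
  a + suc h + k       ≡⟨ regroup₁ a h k ⟩
  suc a + (h + k)     ≡⟨ cong (suc a +_) (sym block) ⟩
  suc a + (N + c)     ≡⟨ regroup₂ a N c ⟩
  (N + suc a) + c     ≡⟨ total ⟩
  k + b               ≡⟨ +-comm k b ⟩
  b + k               ∎)
  where
  open ≡-Reasoning
  regroup₁ : ∀ a h k → a + suc h + k ≡ suc a + (h + k)
  regroup₁ = solve-∀
  regroup₂ : ∀ a N c → suc a + (N + c) ≡ (N + suc a) + c
  regroup₂ = solve-∀

read-block : ∀ c N k w → Descends c (ones N ++ zeros (suc k) ++ true ∷ w) → BlockReading c N k w
read-block c N k w (nn , bal) = record
  { descent-fits = fits
  ; rest-descends = nn-rest , balance-rest N (#1 w) c (suc k) (#0 w) h (sym (m∸n+n≡m fits))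
                                (trans (cong (_+ c) (sym #1-block)) (trans bal #0-block))
  ; ρ-block = trans (ρ-go-ones c 0 N _) (trans (cong (λ z → ρ-go true M z (zeros (suc k) ++ true ∷ w)) (+-identityʳ N))
                    (ρ-go-zeros true M N k (true ∷ w)))
  ; valleys-block = trans (valleys-ones c N _) (valleys-zeros true M k (true ∷ w))
  ; pending-block = trans (pending-ones 0 N _) (pending-zeros true (N + 0) k (true ∷ w))
  }
  where
  M h : ℕ
  M = N + c
  h = blockValley c N k
  nn-block : Nonneg M (zeros (suc k) ++ true ∷ w)
  nn-block = subst (λ z → Nonneg z (zeros (suc k) ++ true ∷ w)) (height-ones c N) (Nonneg-suffix c (ones N) _ nn)
  fits : suc k ≤ M
  fits = Nonneg-zeros⁻ M (suc k) _ nn-block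
  nn-rest : Nonneg (suc h) w
  nn-rest = Nonneg-up⁻ (subst (λ z → Nonneg z (true ∷ w)) (height-zeros-only M (suc k)) (Nonneg-suffix M (zeros (suc k)) _ nn-block))
  #1-block : #1 (ones N ++ zeros (suc k) ++ true ∷ w) ≡ N + suc (#1 w)
  #1-block = trans (#1-++ (ones N) _) (cong₂ _+_ (#1-ones N) (trans (#1-++ (zeros (suc k)) (true ∷ w)) (cong (_+ suc (#1 w)) (#1-zeros (suc k)))))
  #0-block : #0 (ones N ++ zeros (suc k) ++ true ∷ w) ≡ suc k + #0 w
  #0-block = trans (#0-++ (ones N) _) (trans (cong (_+ #0 (zeros (suc k) ++ true ∷ w)) (#0-ones N))
               (trans (#0-++ (zeros (suc k)) (true ∷ w)) (cong (_+ #0 w) (#0-zeros (suc k)))))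

After0-twos-++ : ∀ N X → After0 X → After0 (twos N ++ X)
After0-twos-++ zero X g = g
After0-twos-++ (suc N) X g = After0-twos-++ N X g

After1-twos-++ : ∀ N X → After1 X → After1 (twos N ++ X)
After1-twos-++ zero X g = g
After1-twos-++ (suc N) X g = After1-twos-++ N X g

≢1∧≤1⇒≡0 : ∀ {l} → All (_≢ 1) l → All (_≤ 1) l → All (_≡ 0) l
≢1∧≤1⇒≡0 [] [] = []
≢1∧≤1⇒≡0 (≢1 ∷ a) (z≤n ∷ b) = refl ∷ ≢1∧≤1⇒≡0 a b
≢1∧≤1⇒≡0 (≢1 ∷ a) (s≤s z≤n ∷ b) = ⊥-elim (≢1 refl)

-- The grammar of triwords, read along the valleys: a valley 0 forces all
-- later valleys to be 0, hence all later letters to be 0 or 2.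
After1-block : ∀ N h X V → h ≤ 1 → All (_≤ 1) V → (All (_≡ 0) V → After0 X) → (No01 V → After1 X) →
  No01 (h ∷ V) → After1 (h ∷ (twos N ++ X))
After1-block N zero X V _ ≤1 zeros⇒After0 _ (no1 , _) = After0-twos-++ N X (zeros⇒After0 (≢1∧≤1⇒≡0 (no1 refl) ≤1))
After1-block N (suc zero) X V _ _ _ No01⇒After1 (_ , n01) = After1-twos-++ N X (No01⇒After1 n01)
After1-block N (suc (suc _)) X V (s≤s ()) _ _ _ _

After0-block : ∀ N h X V → (All (_≡ 0) V → After0 X) → All (_≡ 0) (h ∷ V) → After0 (h ∷ (twos N ++ X))
After0-block N .zero X V zeros⇒After0 (refl ∷ a) = After0-twos-++ N X (zeros⇒After0 a)

-- Decoding a block 1ᴺ 0ᵏ⁺¹ 1 w from a decoding of w: the block is drawn by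
-- σ from the letters h 2ᴺ, and the grammar is maintained.
decode-valley : ∀ c N k w → (br : BlockReading c N k w) → blockValley c N k ≤ 1 →
  All (_≤ 1) (valleys true (suc (blockValley c N k)) w) → Decoded (suc (blockValley c N k)) w →
  Decoded c (ones N ++ zeros (suc k) ++ true ∷ w)
decode-valley c N k w br h≤1 ≤1 (w≡σ , No01⇒After1 , zeros⇒After0 , head) =
  sym σ-of-ρ ,
  (λ n01 → subst After1 (sym ρ-block) (After1-block N h out V h≤1 ≤1 zeros⇒After0 No01⇒After1 (subst No01 valleys-block n01))) ,
  (λ z → subst After0 (sym ρ-block) (After0-block N h out V zeros⇒After0 (subst (All (_≡ 0)) valleys-block z))) ,
  subst HeadAtMost1 (sym ρ-block) (inj₂ (h , _ , refl , h≤1))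
  where
  open BlockReading br
  open ≡-Reasoning
  h : ℕ
  h = blockValley c N k
  out V : List ℕ
  out = ρ-go true (suc h) 0 w
  V = valleys true (suc h) w
  σ-of-ρ : σ-tail c (ρ-go true c 0 (ones N ++ zeros (suc k) ++ true ∷ w)) ≡ ones N ++ zeros (suc k) ++ true ∷ w
  σ-of-ρ = begin
    σ-tail c (ρ-go true c 0 (ones N ++ zeros (suc k) ++ true ∷ w))
      ≡⟨ cong (σ-tail c) ρ-block ⟩
    σ-go c h (twos N ++ out)
      ≡⟨ σ-go-twos c h N out ⟩
    ones N ++ σ-go (N + c) h out
      ≡⟨ cong (ones N ++_) (σ-go-next (N + c) h out head) ⟩
    ones N ++ zeros (N + c ∸ h) ++ true ∷ σ-tail (suc h) out
      ≡⟨ cong (λ z → ones N ++ zeros z ++ true ∷ σ-tail (suc h) out) (m∸[m∸n]≡n descent-fits) ⟩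
    ones N ++ zeros (suc k) ++ true ∷ σ-tail (suc h) out
      ≡⟨ cong (λ z → ones N ++ zeros (suc k) ++ true ∷ z) (sym w≡σ) ⟩
    ones N ++ zeros (suc k) ++ true ∷ w ∎

suffix-shorter : ∀ (a : Word) b → length b ≤ length (a ++ b)
suffix-shorter a b = subst (length b ≤_) (sym (length-++ a)) (m≤n+m (length b) (length a))

-- Decoding block by block; the fuel bounds the number of blocks by the length.
decode : ∀ fuel c w → length w ≤ fuel → Descends c w → All (_≤ 1) (valleys true c w) → pending true 0 w ≡ 0 → Decoded c w
decode fuel c w len d ≤1 pend with blocks w
... | final N k = decode-final c N k d pend
... | valley N k w' = decode-valley c N k w' br h≤1 ≤1-rest (decode-rest fuel len)
  where
  br : BlockReading c N k w'
  br = read-block c N k w' d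
  open BlockReading br
  h : ℕ
  h = blockValley c N k
  ≤1-block : All (_≤ 1) (h ∷ valleys true (suc h) w')
  ≤1-block = subst (All (_≤ 1)) valleys-block ≤1
  h≤1 : h ≤ 1
  h≤1 with ≤1-block
  ... | h≤1 ∷ _ = h≤1
  ≤1-rest : All (_≤ 1) (valleys true (suc h) w')
  ≤1-rest with ≤1-block
  ... | _ ∷ ≤1-rest = ≤1-rest
  w'-shorter : suc (length w') ≤ length (ones N ++ zeros (suc k) ++ true ∷ w')
  w'-shorter = ≤-trans (suffix-shorter (zeros (suc k)) (true ∷ w')) (suffix-shorter (ones N) _)
  decode-rest : ∀ fuel → length (ones N ++ zeros (suc k) ++ true ∷ w') ≤ fuel → Decoded (suc h) w'
  decode-rest zero len = ⊥-elim (1+n≰n (≤-trans w'-shorter (≤-trans len z≤n)))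
  decode-rest (suc f) len = decode f (suc h) w' (≤-pred (≤-trans w'-shorter len)) rest-descends ≤1-rest
    (trans (sym pending-block) pend)

ρ-decodes : ∀ n d → 1 ≤ n → Dy (n + 2) d → StartsWith11 d → TopInvariant d →
  IsTri (ρ d) × (d ≡ σ (ρ d)) × (length (ρ d) ≡ n)
ρ-decodes n .(true ∷ true ∷ w) 1≤n ((bal , nn) , len) (w , refl) (≤1 , pend , n01)
  with decode (length w) 2 w ≤-refl (Nonneg-up⁻ (Nonneg-up⁻ nn) , trans (+-comm (#1 w) 2) bal) ≤1
         (n≤0⇒n≡0 (subst (pending true 0 w ≤_) pend (pending-mono true 0 2 w z≤n)))
... | w≡σ , No01⇒After1 , _ , head = is-tri (ρ-go true 2 0 w) head (No01⇒After1 n01) length-ρ , d≡σ , length-ρ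
  where
  d≡σ : true ∷ true ∷ w ≡ σ (ρ-go true 2 0 w)
  d≡σ = cong (λ z → true ∷ true ∷ z) w≡σ
  length-ρ : length (ρ-go true 2 0 w) ≡ n
  length-ρ = +-cancelʳ-≡ 2 _ _ (*-cancelˡ-≡ (length (ρ-go true 2 0 w) + 2) (n + 2) 2
    (trans (sym (proj₂ (σ-Dy (ρ-go true 2 0 w) head))) (trans (cong length (sym d≡σ)) len)))
  is-tri : ∀ u → HeadAtMost1 u → After1 u → length u ≡ n → IsTri u
  is-tri [] _ _ refl = ⊥-elim (1+n≰n (≤-trans 1≤n z≤n))
  is-tri (zero ∷ r) _ g _ = g
  is-tri (suc zero ∷ r) _ g _ = g
  is-tri (suc (suc _) ∷ r) (inj₁ ()) g _
  is-tri (suc (suc _) ∷ r) (inj₂ (_ , _ , refl , s≤s ())) g _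

After0-no-1 : ∀ q r → After0 (q ++ suc zero ∷ r) → ⊥
After0-no-1 [] r ()
After0-no-1 (zero ∷ q) r g = After0-no-1 q r g
After0-no-1 (suc zero ∷ q) r ()
After0-no-1 (suc (suc zero) ∷ q) r g = After0-no-1 q r g
After0-no-1 (suc (suc (suc _)) ∷ q) r ()

After0-after-0 : ∀ p X → After0 (p ++ zero ∷ X) → After0 X
After0-after-0 [] X g = g
After0-after-0 (zero ∷ p) X g = After0-after-0 p X g
After0-after-0 (suc zero ∷ p) X ()
After0-after-0 (suc (suc zero) ∷ p) X g = After0-after-0 p X g
After0-after-0 (suc (suc (suc _)) ∷ p) X ()

After1-after-0 : ∀ p X → After1 (p ++ zero ∷ X) → After0 X
After1-after-0 [] X g = g
After1-after-0 (zero ∷ p) X g = After0-after-0 p X g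
After1-after-0 (suc zero ∷ p) X g = After1-after-0 p X g
After1-after-0 (suc (suc zero) ∷ p) X g = After1-after-0 p X g
After1-after-0 (suc (suc (suc _)) ∷ p) X ()

IsTri⇒After1 : ∀ u → IsTri u → After1 u
IsTri⇒After1 (zero ∷ r) g = g
IsTri⇒After1 (suc zero ∷ r) g = g

IsTri⇒Tr : ∀ n u → IsTri u → length u ≡ n → Tr n u
IsTri⇒Tr n (h ∷ r) g len = len , (s≤s (≤-trans (After-≤1 h r g) (s≤s z≤n)) ∷ below-3 (After-≤2 h r g)) , no-head-2 h g , no-01
  where
  below-3 : ∀ {l} → All (_≤ 2) l → All (λ a → a < 3) l
  below-3 [] = []
  below-3 (p ∷ a) = s≤s p ∷ below-3 a
  no-head-2 : ∀ h → After h r → ∀ w → h ∷ r ≡ 2 ∷ w → ⊥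
  no-head-2 .(suc (suc zero)) () w refl
  no-01 : ∀ p q r' → h ∷ r ≡ p ++ zero ∷ q ++ suc zero ∷ r' → ⊥
  no-01 p q r' e = After0-no-1 q r' (After1-after-0 p _ (subst After1 e (IsTri⇒After1 (h ∷ r) g)))

Tr⇒After0 : ∀ r → All (λ a → a < 3) r → (∀ q r' → r ≡ q ++ suc zero ∷ r' → ⊥) → After0 r
Tr⇒After0 [] a no-1 = tt
Tr⇒After0 (zero ∷ r) (_ ∷ a) no-1 = Tr⇒After0 r a (λ q r' e → no-1 (zero ∷ q) r' (cong (zero ∷_) e))
Tr⇒After0 (suc zero ∷ r) a no-1 = no-1 [] r refl
Tr⇒After0 (suc (suc zero) ∷ r) (_ ∷ a) no-1 = Tr⇒After0 r a (λ q r' e → no-1 (2 ∷ q) r' (cong (2 ∷_) e))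
Tr⇒After0 (suc (suc (suc _)) ∷ r) (s≤s (s≤s (s≤s ())) ∷ a) no-1

Tr⇒After1 : ∀ u → All (λ a → a < 3) u → (∀ p q r → u ≡ p ++ zero ∷ q ++ suc zero ∷ r → ⊥) → After1 u
Tr⇒After1 [] a no-01 = tt
Tr⇒After1 (zero ∷ r) (_ ∷ a) no-01 = Tr⇒After0 r a (λ q r' e → no-01 [] q r' (cong (zero ∷_) e))
Tr⇒After1 (suc zero ∷ r) (_ ∷ a) no-01 = Tr⇒After1 r a (λ p q r' e → no-01 (1 ∷ p) q r' (cong (1 ∷_) e))
Tr⇒After1 (suc (suc zero) ∷ r) (_ ∷ a) no-01 = Tr⇒After1 r a (λ p q r' e → no-01 (2 ∷ p) q r' (cong (2 ∷_) e))
Tr⇒After1 (suc (suc (suc _)) ∷ r) (s≤s (s≤s (s≤s ())) ∷ a) no-01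

Tr⇒IsTri : ∀ n u → 1 ≤ n → Tr n u → IsTri u
Tr⇒IsTri n [] 1≤n (refl , _) = ⊥-elim (1+n≰n (≤-trans 1≤n z≤n))
Tr⇒IsTri n (zero ∷ r) 1≤n (_ , a , _ , no-01) = Tr⇒After1 (zero ∷ r) a no-01
Tr⇒IsTri n (suc zero ∷ r) 1≤n (_ , a , _ , no-01) = Tr⇒After1 (suc zero ∷ r) a no-01
Tr⇒IsTri n (suc (suc zero) ∷ r) 1≤n (_ , _ , no-head-2 , _) = no-head-2 r refl
Tr⇒IsTri n (suc (suc (suc _)) ∷ r) 1≤n (_ , (s≤s (s≤s (s≤s ())) ∷ a) , _ , _)

StartsWith11-chain : ∀ {m d e} → DexLe m d e → StartsWith11 d → StartsWith11 e
StartsWith11-chain ε s11 = s11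
StartsWith11-chain {m} ((_ , _ , step) ◅ rest) s11 = StartsWith11-chain {m} rest (StartsWith11-up step s11)

TopInvariant-chain : ∀ {m d e} → DexLe m d e → TopInvariant e → TopInvariant d
TopInvariant-chain ε inv = inv
TopInvariant-chain {m} (((dy , _) , _ , step) ◅ rest) inv = TopInvariant-down dy step (TopInvariant-chain {m} rest inv)

ρ-monotone : ∀ {m d d'} → DexLe m d d' → StartsWith11 d → TopInvariant d' → ρ d ≼ ρ d'
ρ-monotone ε _ _ = ≼-refl _
ρ-monotone {m} (_◅_ {j = e} ((dy , _) , _ , step) rest) s11 inv' =
  ≼-trans (ρ-step-mono dy step s11 (TopInvariant-down dy step inv-e) inv-e)
          (ρ-monotone {m} rest (StartsWith11-up step s11) inv')
  where
  inv-e : TopInvariant e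
  inv-e = TopInvariant-chain {m} rest inv'

F-decode : ∀ k d → F (suc k) d → IsTri (ρ d) × (d ≡ σ (ρ d)) × (length (ρ d) ≡ suc k)
F-decode k d (dy , from-bottom , to-top) =
  ρ-decodes (suc k) d (s≤s z≤n) dy (StartsWith11-chain {suc k + 2} from-bottom (_ , refl))
    (TopInvariant-chain {suc k + 2} to-top (TopInvariant-Ftop k))

proposition1p4 : (n : ℕ) → 1 ≤ n →
    (∀ d → F n d → Tr n (ρ d)) ×
    (∀ d d′ → F n d → F n d′ → ρ d ≡ ρ d′ → d ≡ d′) ×
    (∀ u → Tr n u → Σ Word λ d → F n d × ρ d ≡ u) ×
    (∀ d d′ → F n d → F n d′ →
      (DexLe (n + 2) d d′ → ρ d ≼ ρ d′) × (ρ d ≼ ρ d′ → DexLe (n + 2) d d′))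
proposition1p4 zero ()
proposition1p4 n@(suc k) _ =
  (λ d f → IsTri⇒Tr n (ρ d) (tri d f) (len d f)) ,
  (λ d d′ f f′ ρ≡ → trans (d≡σρ d f) (trans (cong σ ρ≡) (sym (d≡σρ d′ f′)))) ,
  (λ u tr → let tri-u = Tr⇒IsTri n u (s≤s z≤n) tr in σ u , σ-in-F k u tri-u (proj₁ tr) , ρ-σ u tri-u) ,
  λ d d′ f f′ →
    (λ d≤d′ → ρ-monotone {n + 2} d≤d′ (StartsWith11-chain {n + 2} (proj₁ (proj₂ f)) (_ , refl))
                (TopInvariant-chain {n + 2} (proj₂ (proj₂ f′)) (TopInvariant-Ftop k))) ,
    (λ ρ≼ → subst₂ (DexLe (n + 2)) (sym (d≡σρ d f)) (sym (d≡σρ d′ f′))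
              (σ-monotone n (ρ d) (ρ d′) (tri d f) (tri d′ f′) (len d f) (len d′ f′) ρ≼))
  where
  tri : ∀ d → F n d → IsTri (ρ d)
  tri d f = proj₁ (F-decode k d f)
  d≡σρ : ∀ d → F n d → d ≡ σ (ρ d)
  d≡σρ d f = proj₁ (proj₂ (F-decode k d f))
  len : ∀ d → F n d → length (ρ d) ≡ n
  len d f = proj₂ (proj₂ (F-decode k d f))
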